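{- Let $k\ge 1$, $n$, $m$ be integers with $1\le m\le n-k$, and write $n-m=sk+t$ with integers $s\ge 0$ and $0\le t<k$. Let $G$ be a connected simple graph of order $n$ with vertex $k$-partiteness $v_k(G)\le m$. Then $$W(G)\ge \frac{n^2-m}{2}+\frac{(n-m)(s-2)}{2}+\frac{t(s+1)}{2},$$ with equality if and only if $G\cong K_m\vee\big((k-t)\overline{K_s}\vee t\overline{K_{s+1}}\big)$.
   Context: A graph is $k$-partite if its vertex set can be partitioned into $k$ (possibly empty) sets each inducing no edges. The vertex $k$-partiteness $v_k(G)$ is the minimum number of vertices whose deletion from $G$ yields a $k$-partite graph. The Wiener index is $W(G)=\sum_{\{u,v\}\subseteq V(G)}d(u,v)$ over unordered pairs of distinct vertices, $d(u,v)$ the shortest-path distance. $G_1\vee G_2$ (join) is the disjoint union of $G_1,G_2$ plus all edges between $V(G_1)$ and $V(G_2)$; $\overline{K_r}$ is the edgeless graph on $r$ vertices; $(k-t)\overline{K_s}\vee t\overline{K_{s+1}}$ denotes the join of $k-t$ copies of $\overline{K_s}$ and $t$ copies of $\overline{K_{s+1}}$, i.e. the complete $k$-partite graph with $k-t$ parts of size $s$ and $t$ parts of size $s+1$. -}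

module Defs where

open import Data.Nat using (ℕ; zero; suc; _+_; _*_; _<ᵇ_; _≤_)
open import Data.Bool using (Bool; true; false; _∨_; _∧_; not; if_then_else_; T)
open import Data.Fin using (Fin; splitAt; toℕ; _≟_)
open import Data.Fin.Subset using (Subset; _∉_; ∣_∣)
open import Data.Sum using (inj₁; inj₂)
open import Data.List using (allFin)
open import Data.Bool.ListAction using (any)
open import Data.Product using (_×_; Σ; ∃-syntax)
open import Function using (_∘_)
open import Function.Bundles using (_↔_; Inverse)
open import Relation.Nullary using (¬_)
open import Relation.Nullary.Decidable using (⌊_⌋)
open import Relation.Binary.PropositionalEquality using (_≡_)

Adj : ℕ → Set
Adj n = Fin n → Fin n → Bool

IsSimple : ∀ {n} → Adj n → Set
IsSimple {n} A = (∀ (u v : Fin n) → A u v ≡ A v u) × (∀ (u : Fin n) → A u u ≡ false)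

reach : ∀ {n} → Adj n → ℕ → Fin n → Fin n → Bool
reach A zero    u v = ⌊ u ≟ v ⌋
reach A (suc j) u v = reach A j u v ∨ any (λ w → reach A j u w ∧ A w v) (allFin _)

Connected : ∀ {n} → Adj n → Set
Connected {n} A = ∀ (u v : Fin n) → ∃[ j ] T (reach A j u v)

-- least j < b with p j, and b if there is none
leastBelow : (ℕ → Bool) → ℕ → ℕ
leastBelow p zero    = zero
leastBelow p (suc b) = if p zero then zero else suc (leastBelow (p ∘ suc) b)

-- shortest-path distance (length of a shortest walk); in a connected graph
-- on n vertices a shortest walk has length < n, so the search bound n suffices.
dist : ∀ {n} → Adj n → Fin n → Fin n → ℕ
dist {n} A u v = leastBelow (λ j → reach A j u v) n

sumFin : ∀ n → (Fin n → ℕ) → ℕ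
sumFin zero    f = zero
sumFin (suc n) f = f Fin.zero + sumFin n (f ∘ Fin.suc)

wiener : ∀ {n} → Adj n → ℕ
wiener {n} A = sumFin n (λ u → sumFin n (λ v → if toℕ u <ᵇ toℕ v then dist A u v else zero))

KPartiteAfterDeleting : ∀ {n} → ℕ → Adj n → Subset n → Set
KPartiteAfterDeleting {n} k A S =
  Σ (Fin n → Fin k) λ c → ∀ (u v : Fin n) → u ∉ S → v ∉ S → T (A u v) → ¬ (c u ≡ c v)

VertexKPartitenessAtMost : ∀ {n} → ℕ → Adj n → ℕ → Set
VertexKPartitenessAtMost {n} k A m = Σ (Subset n) λ S → ∣ S ∣ ≤ m × KPartiteAfterDeleting k A S

complete : ∀ m → Adj m
complete m u v = not ⌊ u ≟ v ⌋

edgeless : ∀ r → Adj r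
edgeless r u v = false

join : ∀ {a b} → Adj a → Adj b → Adj (a + b)
join {a} A B u v with splitAt a u | splitAt a v
... | inj₁ x | inj₁ y = A x y
... | inj₂ x | inj₂ y = B x y
... | inj₁ _ | inj₂ _ = true
... | inj₂ _ | inj₁ _ = true

joinCopies : ∀ c r → Adj (c * r)
joinCopies zero    r = edgeless zero
joinCopies (suc c) r = join (edgeless r) (joinCopies c r)

_≅_ : ∀ {n N} → Adj n → Adj N → Set
_≅_ {n} {N} A B = Σ (Fin n ↔ Fin N) λ f →
  ∀ (u v : Fin n) → A u v ≡ B (Inverse.to f u) (Inverse.to f v)

module Submission where

-- Delete a set of at most m vertices and colour the rest properly with k
-- colours: every vertex is now "deleted" or lies in a colour class.  For any
-- such proper labelling we prove the exact identity
--   2W(G) = bound + distExcess + missingEdges + imbalance + 2s(m − #deleted),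
-- where distExcess measures distances above 1 (edges) and 2 (non-edges),
-- missingEdges counts non-adjacent pairs in different classes, and imbalance
-- is Σᵢ (aᵢ − s)(aᵢ − s − 1) over the class sizes aᵢ.  It follows from
-- counting ordered pairs of vertices (2W against Σ aᵢ²) and from the
-- parabola–secant inequality aᵢ² + s(s + 1) ≥ (2s + 1)aᵢ.  Every excess is
-- ≥ 0, which is the bound.  Equality kills every excess: G is then complete
-- multipartite over its labelling, with m deleted vertices adjacent to all
-- others and classes of sizes s and s + 1, and sorting the classes by size
-- gives an isomorphism onto the extremal graph.  Conversely the labelling
-- inherited from the extremal graph has no excess.

module FiniteSums where

  open import Defs
  open import Data.Nat using (ℕ; zero; suc; _+_; _*_; _∸_; _≤_; _<_; z≤n; s≤s)
  open import Data.Nat.Properties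
    using (+-identityʳ; +-assoc; *-zeroʳ; *-identityʳ; *-distribˡ-+; *-comm;
           m+[n∸m]≡n; m+n≡0⇒m≡0; m+n≡0⇒n≡0; +-commutativeSemigroup)
  open import Algebra.Properties.CommutativeSemigroup +-commutativeSemigroup using (interchange)
  open import Data.Bool using (Bool; if_then_else_)
  open import Data.Fin using (Fin; _↑ˡ_; _↑ʳ_; _≟_)
  open import Data.Product using (_,_; ∃-syntax)
  open import Relation.Nullary using (does)
  open import Relation.Binary.PropositionalEquality
  open import Function using (_∘_)

  χ : Bool → ℕ
  χ b = if b then 1 else 0

  sumFin-cong : ∀ n {f g : Fin n → ℕ} → (∀ i → f i ≡ g i) → sumFin n f ≡ sumFin n g
  sumFin-cong zero    h = refl
  sumFin-cong (suc n) h = cong₂ _+_ (h Fin.zero) (sumFin-cong n (h ∘ Fin.suc))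

  sumFin-+ : ∀ n (f g : Fin n → ℕ) → sumFin n (λ i → f i + g i) ≡ sumFin n f + sumFin n g
  sumFin-+ zero    f g = refl
  sumFin-+ (suc n) f g =
    trans (cong (f Fin.zero + g Fin.zero +_) (sumFin-+ n (f ∘ Fin.suc) (g ∘ Fin.suc)))
          (interchange (f Fin.zero) (g Fin.zero) _ _)

  sumFin-* : ∀ n c (f : Fin n → ℕ) → sumFin n (λ i → c * f i) ≡ c * sumFin n f
  sumFin-* zero    c f = sym (*-zeroʳ c)
  sumFin-* (suc n) c f =
    trans (cong (c * f Fin.zero +_) (sumFin-* n c (f ∘ Fin.suc))) (sym (*-distribˡ-+ c _ _))

  sumFin-const : ∀ n c → sumFin n (λ _ → c) ≡ n * c
  sumFin-const zero    c = refl
  sumFin-const (suc n) c = cong (c +_) (sumFin-const n c)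

  sumFin-one : ∀ n → sumFin n (λ _ → 1) ≡ n
  sumFin-one n = trans (sumFin-const n 1) (*-identityʳ n)

  sumFin-zero : ∀ n → sumFin n (λ _ → 0) ≡ 0
  sumFin-zero n = trans (sumFin-const n 0) (*-zeroʳ n)

  sumFin-swap : ∀ n m (g : Fin n → Fin m → ℕ) →
    sumFin n (λ u → sumFin m (g u)) ≡ sumFin m (λ v → sumFin n (λ u → g u v))
  sumFin-swap zero    m g = sym (sumFin-zero m)
  sumFin-swap (suc n) m g =
    trans (cong (sumFin m (g Fin.zero) +_) (sumFin-swap n m (g ∘ Fin.suc)))
          (sym (sumFin-+ m (g Fin.zero) _))

  sumFin-delta : ∀ n (j : Fin n) (g : Fin n → ℕ) →
    sumFin n (λ i → if does (j ≟ i) then g i else 0) ≡ g j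
  sumFin-delta (suc n) Fin.zero    g = trans (cong (g Fin.zero +_) (sumFin-zero n)) (+-identityʳ _)
  sumFin-delta (suc n) (Fin.suc j) g = sumFin-delta n j (g ∘ Fin.suc)

  sumFin-product : ∀ n (x y : Fin n → ℕ) →
    sumFin n (λ u → sumFin n (λ v → x u * y v)) ≡ sumFin n x * sumFin n y
  sumFin-product n x y = begin
    sumFin n (λ u → sumFin n (λ v → x u * y v)) ≡⟨ sumFin-cong n (λ u → sumFin-* n (x u) y) ⟩
    sumFin n (λ u → x u * sumFin n y)            ≡⟨ sumFin-cong n (λ u → *-comm (x u) _) ⟩
    sumFin n (λ u → sumFin n y * x u)            ≡⟨ sumFin-* n (sumFin n y) x ⟩
    sumFin n y * sumFin n x                      ≡⟨ *-comm (sumFin n y) _ ⟩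
    sumFin n x * sumFin n y                      ∎
    where open ≡-Reasoning

  sumFin-slack : ∀ n (f g : Fin n → ℕ) → (∀ i → f i ≤ g i) →
    sumFin n g ≡ sumFin n f + sumFin n (λ i → g i ∸ f i)
  sumFin-slack n f g h = trans (sumFin-cong n (λ i → sym (m+[n∸m]≡n (h i)))) (sumFin-+ n f _)

  sumFin-0⇒ : ∀ n (f : Fin n → ℕ) → sumFin n f ≡ 0 → ∀ i → f i ≡ 0
  sumFin-0⇒ (suc n) f h Fin.zero    = m+n≡0⇒m≡0 (f Fin.zero) h
  sumFin-0⇒ (suc n) f h (Fin.suc i) = sumFin-0⇒ n (f ∘ Fin.suc) (m+n≡0⇒n≡0 (f Fin.zero) h) i

  ⇒sumFin-0 : ∀ n (f : Fin n → ℕ) → (∀ i → f i ≡ 0) → sumFin n f ≡ 0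
  ⇒sumFin-0 n f h = trans (sumFin-cong n h) (sumFin-zero n)

  sumFin-pos : ∀ n (f : Fin n → ℕ) → 0 < sumFin n f → ∃[ i ] 0 < f i
  sumFin-pos (suc n) f h with f Fin.zero in eq
  ... | suc _ = Fin.zero , subst (0 <_) (sym eq) (s≤s z≤n)
  ... | zero with sumFin-pos n (f ∘ Fin.suc) h
  ...   | i , p = Fin.suc i , p

  sumFin-++ : ∀ a b (f : Fin (a + b) → ℕ) →
    sumFin (a + b) f ≡ sumFin a (λ i → f (i ↑ˡ b)) + sumFin b (λ j → f (a ↑ʳ j))
  sumFin-++ zero    b f = refl
  sumFin-++ (suc a) b f =
    trans (cong (f Fin.zero +_) (sumFin-++ a b (f ∘ Fin.suc))) (sym (+-assoc (f Fin.zero) _ _))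

module Distances where

  open import Defs
  open import Data.Nat using (ℕ; zero; suc; _≤_; z≤n; s≤s)
  open import Data.Bool using (true; false; if_then_else_; T; _∧_)
  open import Data.Bool.Properties using (T-∧; T-∨; T-≡)
  open import Data.Fin using (Fin; zero; _≟_)
  open import Data.List using (allFin)
  open import Data.List.Membership.Propositional using (lose)
  open import Data.List.Membership.Propositional.Properties using (∈-allFin)
  open import Data.List.Relation.Unary.Any using (satisfied)
  open import Data.List.Relation.Unary.Any.Properties using (any⁺; any⁻)
  open import Data.Product using (_,_)
  open import Data.Sum using (inj₁; inj₂)
  open import Function.Bundles using (Equivalence)
  open import Relation.Nullary using (yes; no; ¬_; contradiction)
  open import Relation.Nullary.Decidable using (⌊_⌋; toWitness)
  open import Relation.Binary.PropositionalEquality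

  open Equivalence using (to; from)

  -- The graphs of Defs test equality with ⌊_⌋, which does not compute under
  -- Fin.suc; these are its two evaluations.  Elsewhere we use `does`, which does.
  ≟-refl : ∀ {n} (i : Fin n) → ⌊ i ≟ i ⌋ ≡ true
  ≟-refl i with i ≟ i
  ... | yes _ = refl
  ... | no ne = contradiction refl ne

  ≟-≢ : ∀ {n} {i j : Fin n} → ¬ i ≡ j → ⌊ i ≟ j ⌋ ≡ false
  ≟-≢ {i = i} {j} i≢j with i ≟ j
  ... | yes e = contradiction e i≢j
  ... | no _  = refl

  leastBelow-≥1 : ∀ p b → p 0 ≡ false → 1 ≤ leastBelow p (suc b)
  leastBelow-≥1 p b h rewrite h = s≤s z≤n

  leastBelow-≥2 : ∀ p b → p 0 ≡ false → p 1 ≡ false → 2 ≤ leastBelow p (suc (suc b))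
  leastBelow-≥2 p b h₀ h₁ rewrite h₀ | h₁ = s≤s (s≤s z≤n)

  leastBelow-≡1 : ∀ p b → p 0 ≡ false → p 1 ≡ true → leastBelow p (suc (suc b)) ≡ 1
  leastBelow-≡1 p b h₀ h₁ rewrite h₀ | h₁ = refl

  leastBelow-≡2 : ∀ p b → p 0 ≡ false → p 1 ≡ false → p 2 ≡ true → leastBelow p (suc (suc b)) ≡ 2
  leastBelow-≡2 p zero    h₀ h₁ h₂ rewrite h₀ | h₁ = refl
  leastBelow-≡2 p (suc b) h₀ h₁ h₂ rewrite h₀ | h₁ | h₂ = refl

  module _ {n : ℕ} (A : Adj n) where

    reach-step : ∀ j u w v → T (reach A j u w) → T (A w v) → T (reach A (suc j) u v)
    reach-step j u w v r a = from T-∨ (inj₂ (any⁺ _ (lose (∈-allFin w) (from T-∧ (r , a)))))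

    reach-one⁻ : ∀ u v → ¬ u ≡ v → T (reach A 1 u v) → T (A u v)
    reach-one⁻ u v u≢v r with to T-∨ r
    ... | inj₁ u≡v = contradiction (toWitness u≡v) u≢v
    ... | inj₂ r′ with satisfied (any⁻ (λ w → reach A 0 u w ∧ A w v) (allFin n) r′)
    ...   | w , uw∧wv with to (T-∧ {reach A 0 u w} {A w v}) uw∧wv
    ...     | u≡w , wv rewrite toWitness {a? = u ≟ w} u≡w = wv

    reach-one : ∀ u v → ¬ u ≡ v → reach A 1 u v ≡ A u v
    reach-one u v u≢v with A u v in uv | reach A 1 u v in r
    ... | true  | true  = refl
    ... | false | false = refl
    ... | false | true  = contradiction (trans (sym uv) (to T-≡ (reach-one⁻ u v u≢v (from T-≡ r)))) λ ()
    ... | true  | false =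
      trans (sym r) (to T-≡ (reach-step 0 u u v (from T-≡ (≟-refl u)) (from T-≡ uv)))

    reach-two : ∀ u w v → A u w ≡ true → A w v ≡ true → reach A 2 u v ≡ true
    reach-two u w v uw wv = to T-≡
      (reach-step 1 u w v (reach-step 0 u u w (from T-≡ (≟-refl u)) (from T-≡ uw)) (from T-≡ wv))

  minDist : ∀ {n} → Adj n → Fin n → Fin n → ℕ
  minDist A u v = if A u v then 1 else 2

  dist-≥ : ∀ {n} (A : Adj n) u v → ¬ u ≡ v → minDist A u v ≤ dist A u v
  dist-≥ {suc zero} A zero zero u≢v = contradiction refl u≢v
  dist-≥ {suc (suc b)} A u v u≢v with A u v in uv
  ... | true  = leastBelow-≥1 (λ j → reach A j u v) (suc b) (≟-≢ u≢v)
  ... | false = leastBelow-≥2 (λ j → reach A j u v) b (≟-≢ u≢v) (trans (reach-one A u v u≢v) uv)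

  dist-adjacent : ∀ {n} (A : Adj n) u v → ¬ u ≡ v → A u v ≡ true → dist A u v ≡ 1
  dist-adjacent {suc zero} A zero zero u≢v _ = contradiction refl u≢v
  dist-adjacent {suc (suc b)} A u v u≢v uv =
    leastBelow-≡1 (λ j → reach A j u v) b (≟-≢ u≢v) (trans (reach-one A u v u≢v) uv)

  dist-common : ∀ {n} (A : Adj n) u w v → ¬ u ≡ v →
    A u v ≡ false → A u w ≡ true → A w v ≡ true → dist A u v ≡ 2
  dist-common {suc zero} A zero w zero u≢v _ _ _ = contradiction refl u≢v
  dist-common {suc (suc b)} A u w v u≢v uv uw wv = leastBelow-≡2 (λ j → reach A j u v) b
    (≟-≢ u≢v) (trans (reach-one A u v u≢v) uv) (reach-two A u w v uw wv)

module Arithmetic where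

  open import Data.Nat using (ℕ; zero; suc; _+_; _*_; _∸_; _≤_; compare; less; equal; greater)
  open import Data.Nat.Properties
    using (+-identityʳ; n∸n≡0; m+n∸m≡n; m+n∸n≡m; m≤m+n; m+[n∸m]≡n; +-cancelʳ-≡; +-cancelˡ-≡;
           +-commutativeSemigroup)
  open import Algebra.Properties.CommutativeSemigroup +-commutativeSemigroup using (x∙yz≈y∙xz)
  open import Data.Nat.Tactic.RingSolver using (solve-∀)
  open import Data.Integer using (ℤ; +_; _-_)
  import Data.Integer as I
  import Data.Integer.Properties as IP
  import Data.Integer.Tactic.RingSolver as IR
  open import Data.Sum using (_⊎_; inj₁; inj₂)
  open import Data.Product using (_×_; _,_; ∃-syntax)
  open import Relation.Binary.PropositionalEquality
  open import Algebra.Bundles using (AbelianGroup)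
  open import Algebra.Properties.Group (AbelianGroup.group IP.+-0-abelianGroup) using (identityʳ-unique)

  -- The Wiener bound of the theorem, (n² − m) + (n − m)(s − 2) + t(s + 1); it is
  -- twice the claimed lower bound for W, so that everything stays integral.
  wienerBound : ℕ → ℕ → ℕ → ℕ → ℤ
  wienerBound n m s t = (+ (n * n) - + m) I.+ (+ (n ∸ m)) I.* (+ s - + 2) I.+ + (t * suc s)

  -- Parabola versus secant: the line (2s + 1)x − s(s + 1) through the points of
  -- x² at x = s and x = s + 1 lies below x² at every integer, and meets it only there:
  -- a² + s(s + 1) = (2s + 1)a + (a − s)(a − s − 1).
  parabola secant : ℕ → ℕ → ℕ
  parabola a s = a * a + s * suc s
  secant   a s = (2 * s + 1) * a

  parabola-secant : ∀ a s →
    ∃[ r ] (parabola a s ≡ secant a s + r × (r ≡ 0 → a ≡ s ⊎ a ≡ suc s))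
  parabola-secant a s with compare a s
  ... | less a d = suc d * suc (suc d) , expand a d , λ ()
    where
    expand : ∀ x y → x * x + suc (x + y) * suc (suc (x + y))
                   ≡ (2 * suc (x + y) + 1) * x + suc y * suc (suc y)
    expand = solve-∀
  ... | equal a = 0 , expand a , λ _ → inj₁ refl
    where
    expand : ∀ x → x * x + x * suc x ≡ (2 * x + 1) * x + 0
    expand = solve-∀
  ... | greater s d = suc d * d , expand s d , touching d
    where
    expand : ∀ x y → suc (x + y) * suc (x + y) + x * suc x ≡ (2 * x + 1) * suc (x + y) + suc y * y
    expand = solve-∀
    touching : ∀ d → suc d * d ≡ 0 → suc (s + d) ≡ s ⊎ suc (s + d) ≡ suc s
    touching zero _ = inj₂ (cong suc (+-identityʳ s))

  secant≤parabola : ∀ a s → secant a s ≤ parabola a s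
  secant≤parabola a s with parabola-secant a s
  ... | r , eq , _ = subst (secant a s ≤_) (sym eq) (m≤m+n _ r)

  secant≡parabola⇒ : ∀ a s → parabola a s ∸ secant a s ≡ 0 → a ≡ s ⊎ a ≡ suc s
  secant≡parabola⇒ a s h with parabola-secant a s
  ... | r , eq , touch =
    touch (trans (sym (m+n∸m≡n (secant a s) r)) (trans (cong (_∸ secant a s) (sym eq)) h))

  ⇒secant≡parabola : ∀ a s → a ≡ s ⊎ a ≡ suc s → parabola a s ∸ secant a s ≡ 0
  ⇒secant≡parabola a s (inj₁ refl) = trans (cong (_∸ secant a a) (expand a)) (n∸n≡0 (secant a a))
    where
    expand : ∀ x → x * x + x * suc x ≡ (2 * x + 1) * x
    expand = solve-∀
  ⇒secant≡parabola a s (inj₂ refl) = trans (cong (_∸ secant (suc s) s) (expand s)) (n∸n≡0 (secant (suc s) s))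
    where
    expand : ∀ x → suc x * suc x + x * suc x ≡ (2 * x + 1) * suc x
    expand = solve-∀

  -- The identity behind the bound, in ℕ: with n = N + m vertices, N = sk + t and
  -- N + e labelled vertices, the two counting identities of a labelled graph (all
  -- pairs of vertices; the classes of the labelling) combine into
  -- W + 2N + m = n² + Ns + t(s + 1) + E, where W is twice the Wiener index and
  -- E = ε₁ + ε₂ + ε₃ + 2se collects the excesses.
  counting-identity : ∀ W Q ε₁ ε₂ ε₃ k s t e m → let N = s * k + t; n = N + m in
    W + n + (N + e) ≡ n * n + Q + ε₁ + ε₂ →
    Q + k * (s * suc s) ≡ (2 * s + 1) * (N + e) + ε₃ →
    W + 2 * N + m ≡ n * n + N * s + t * suc s + (ε₁ + ε₂ + ε₃ + 2 * s * e)
  counting-identity W Q ε₁ ε₂ ε₃ k s t e m pairs classes =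
    +-cancelʳ-≡ (n + (N + e) + Q + k * (s * suc s)) _ _ (begin
      W + 2 * N + m + (n + (N + e) + Q + k * (s * suc s))
        ≡⟨ regroup W Q ε₁ ε₂ ε₃ k s t e m ⟩
      (W + n + (N + e)) + (Q + k * (s * suc s)) + (2 * N + m)
        ≡⟨ cong₂ (λ x y → x + y + (2 * N + m)) pairs classes ⟩
      (n * n + Q + ε₁ + ε₂) + ((2 * s + 1) * (N + e) + ε₃) + (2 * N + m)
        ≡⟨ expand W Q ε₁ ε₂ ε₃ k s t e m ⟩
      n * n + N * s + t * suc s + (ε₁ + ε₂ + ε₃ + 2 * s * e) + (n + (N + e) + Q + k * (s * suc s)) ∎)
    where
    open ≡-Reasoning
    N n : ℕ
    N = s * k + t
    n = N + m
    regroup : ∀ W Q ε₁ ε₂ ε₃ k s t e m →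
      W + 2 * (s * k + t) + m + ((s * k + t + m) + ((s * k + t) + e) + Q + k * (s * suc s))
      ≡ (W + (s * k + t + m) + ((s * k + t) + e)) + (Q + k * (s * suc s)) + (2 * (s * k + t) + m)
    regroup = solve-∀
    expand : ∀ W Q ε₁ ε₂ ε₃ k s t e m →
      ((s * k + t + m) * (s * k + t + m) + Q + ε₁ + ε₂) + ((2 * s + 1) * ((s * k + t) + e) + ε₃)
        + (2 * (s * k + t) + m)
      ≡ (s * k + t + m) * (s * k + t + m) + (s * k + t) * s + t * suc s + (ε₁ + ε₂ + ε₃ + 2 * s * e)
        + ((s * k + t + m) + ((s * k + t) + e) + Q + k * (s * suc s))
    expand = solve-∀

  counting-identityℤ : ∀ W nn N m s ts E → W + 2 * N + m ≡ nn + N * s + ts + E →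
    + W ≡ (+ nn - + m) I.+ (+ N) I.* (+ s - + 2) I.+ + ts I.+ + E
  counting-identityℤ W nn N m s ts E h = begin
    + W                                                      ≡⟨ cancel (+ W) (+ N) (+ m) ⟩
    (+ W I.+ + 2 I.* + N I.+ + m) - (+ 2 I.* + N I.+ + m)     ≡⟨ cong (_- (+ 2 I.* + N I.+ + m)) lift ⟩
    (+ nn I.+ + N I.* + s I.+ + ts I.+ + E) - (+ 2 I.* + N I.+ + m) ≡⟨ rearrange (+ nn) (+ N) (+ m) (+ s) (+ ts) (+ E) ⟩
    (+ nn - + m) I.+ (+ N) I.* (+ s - + 2) I.+ + ts I.+ + E   ∎
    where
    open ≡-Reasoning
    lift : + W I.+ + 2 I.* + N I.+ + m ≡ + nn I.+ + N I.* + s I.+ + ts I.+ + E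
    lift = begin
      + W I.+ + 2 I.* + N I.+ + m    ≡⟨ cong (λ x → + W I.+ x I.+ + m) (sym (IP.pos-* 2 N)) ⟩
      + W I.+ + (2 * N) I.+ + m      ≡⟨ cong (I._+ + m) (sym (IP.pos-+ W (2 * N))) ⟩
      + (W + 2 * N) I.+ + m          ≡⟨ sym (IP.pos-+ (W + 2 * N) m) ⟩
      + (W + 2 * N + m)              ≡⟨ cong +_ h ⟩
      + (nn + N * s + ts + E)        ≡⟨ IP.pos-+ (nn + N * s + ts) E ⟩
      + (nn + N * s + ts) I.+ + E    ≡⟨ cong (I._+ + E) (IP.pos-+ (nn + N * s) ts) ⟩
      + (nn + N * s) I.+ + ts I.+ + E ≡⟨ cong (λ x → x I.+ + ts I.+ + E) (IP.pos-+ nn (N * s)) ⟩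
      + nn I.+ + (N * s) I.+ + ts I.+ + E ≡⟨ cong (λ x → + nn I.+ x I.+ + ts I.+ + E) (IP.pos-* N s) ⟩
      + nn I.+ + N I.* + s I.+ + ts I.+ + E ∎
    cancel : ∀ W N m → W ≡ (W I.+ + 2 I.* N I.+ m) - (+ 2 I.* N I.+ m)
    cancel = IR.solve-∀
    rearrange : ∀ nn N m s ts E →
      (nn I.+ N I.* s I.+ ts I.+ E) - (+ 2 I.* N I.+ m) ≡ (nn - m) I.+ N I.* (s - + 2) I.+ ts I.+ E
    rearrange = IR.solve-∀

  -- The two counting identities of a labelled graph give 2W = bound + excess;
  -- here D ≤ m is the number of deleted vertices and N' = n − D.
  bound-from-counting : ∀ {W n N' Q ε₁ ε₂ ε₃ D} k s t m →
    W + n + N' ≡ n * n + Q + ε₁ + ε₂ →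
    Q + k * (s * suc s) ≡ (2 * s + 1) * N' + ε₃ →
    D + N' ≡ n → n ≡ (s * k + t) + m → D ≤ m →
    + W ≡ wienerBound n m s t I.+ + (ε₁ + ε₂ + ε₃ + 2 * s * (m ∸ D))
  bound-from-counting {W} {N' = N'} {Q} {ε₁} {ε₂} {ε₃} {D} k s t m pairs classes split refl D≤m =
    subst (λ x → + W ≡ (+ (n * n) - + m) I.+ (+ x) I.* (+ s - + 2) I.+ + (t * suc s) I.+ + E)
          (sym (m+n∸n≡m N m))
          (counting-identityℤ W (n * n) N m s (t * suc s) E
            (counting-identity W Q ε₁ ε₂ ε₃ k s t e m
              (subst (λ x → W + n + x ≡ n * n + Q + ε₁ + ε₂) N'≡ pairs)
              (subst (λ x → Q + k * (s * suc s) ≡ (2 * s + 1) * x + ε₃) N'≡ classes)))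
    where
    N n : ℕ
    N = s * k + t
    n = N + m
    e E : ℕ
    e = m ∸ D
    E = ε₁ + ε₂ + ε₃ + 2 * s * e
    N'≡ : N' ≡ N + e
    N'≡ = +-cancelˡ-≡ D _ _ (begin
      D + N'       ≡⟨ split ⟩
      N + m         ≡⟨ cong (λ x → N + x) (sym (m+[n∸m]≡n D≤m)) ⟩
      N + (D + e)  ≡⟨ x∙yz≈y∙xz N D e ⟩
      D + (N + e)  ∎)
      where open ≡-Reasoning

  excess-vanishes : ∀ b E → b I.+ + E ≡ b → E ≡ 0
  excess-vanishes b E h = IP.+-injective (identityʳ-unique b (+ E) h)

module PairSums where

  open import Defs
  open FiniteSums
  open import Data.Nat using (ℕ; _+_; _*_; _∸_; _≤_; _<_; _<ᵇ_)
  open import Data.Nat.Properties using (+-identityʳ; m+[n∸m]≡n; <ᵇ⇒<; <⇒<ᵇ; <⇒≯; <-cmp; n≮n)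
  open import Data.Bool using (Bool; true; false; if_then_else_; not)
  open import Data.Bool.Properties using (T-≡)
  open import Data.Fin using (Fin; toℕ; _≟_)
  open import Data.Fin.Properties using (toℕ-injective)
  open import Function.Bundles using (Equivalence)
  open import Relation.Nullary using (yes; no; does; ¬_; contradiction)
  open import Relation.Nullary.Decidable using (dec-false)
  open import Relation.Binary using (tri<; tri≈; tri>)
  open import Relation.Binary.PropositionalEquality

  open Equivalence using (to; from)

  ΣΣ : ∀ n → (Fin n → Fin n → ℕ) → ℕ
  ΣΣ n f = sumFin n (λ u → sumFin n (f u))

  ΣΣ-cong : ∀ n {f g : Fin n → Fin n → ℕ} → (∀ u v → f u v ≡ g u v) → ΣΣ n f ≡ ΣΣ n g
  ΣΣ-cong n h = sumFin-cong n (λ u → sumFin-cong n (h u))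

  ΣΣ-+ : ∀ n (f g : Fin n → Fin n → ℕ) → ΣΣ n (λ u v → f u v + g u v) ≡ ΣΣ n f + ΣΣ n g
  ΣΣ-+ n f g = trans (sumFin-cong n (λ u → sumFin-+ n (f u) (g u))) (sumFin-+ n _ _)

  ΣΣ-slack : ∀ n (f g : Fin n → Fin n → ℕ) → (∀ u v → f u v ≤ g u v) →
    ΣΣ n g ≡ ΣΣ n f + ΣΣ n (λ u v → g u v ∸ f u v)
  ΣΣ-slack n f g h = trans (ΣΣ-cong n (λ u v → sym (m+[n∸m]≡n (h u v)))) (ΣΣ-+ n f _)

  ΣΣ-0⇒ : ∀ n (f : Fin n → Fin n → ℕ) → ΣΣ n f ≡ 0 → ∀ u v → f u v ≡ 0
  ΣΣ-0⇒ n f h u v = sumFin-0⇒ n (f u) (sumFin-0⇒ n _ h u) v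

  ⇒ΣΣ-0 : ∀ n (f : Fin n → Fin n → ℕ) → (∀ u v → f u v ≡ 0) → ΣΣ n f ≡ 0
  ⇒ΣΣ-0 n f h = ⇒sumFin-0 n _ (λ u → ⇒sumFin-0 n _ (h u))

  before distinct : ∀ {n} → Fin n → Fin n → Bool
  before u v = toℕ u <ᵇ toℕ v
  distinct u v = not (does (u ≟ v))

  before⇒≢ : ∀ {n} (u v : Fin n) → before u v ≡ true → ¬ u ≡ v
  before⇒≢ u v h refl = n≮n (toℕ u) (<ᵇ⇒< (toℕ u) (toℕ u) (from T-≡ h))

  not-before : ∀ {n} (u v : Fin n) → ¬ toℕ u < toℕ v → before u v ≡ false
  not-before u v u≮v with before u v in b
  ... | true  = contradiction (<ᵇ⇒< (toℕ u) (toℕ v) (from T-≡ b)) u≮v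
  ... | false = refl

  ≢⇒distinct : ∀ {n} {u v : Fin n} → ¬ u ≡ v → distinct u v ≡ true
  ≢⇒distinct {u = u} {v} u≢v = cong not (dec-false (u ≟ v) u≢v)

  distinct-split : ∀ {n} (u v : Fin n) (x : ℕ) →
    (if distinct u v then x else 0) ≡ (if before u v then x else 0) + (if before v u then x else 0)
  distinct-split u v x with u ≟ v
  ... | yes refl rewrite not-before u u (n≮n (toℕ u)) = refl
  ... | no u≢v with <-cmp (toℕ u) (toℕ v)
  ...   | tri< u<v _ _ rewrite Equivalence.to T-≡ (<⇒<ᵇ u<v) | not-before v u (<⇒≯ u<v) = sym (+-identityʳ x)
  ...   | tri≈ _ u=v _ = contradiction (toℕ-injective u=v) u≢v
  ...   | tri> _ _ v<u rewrite Equivalence.to T-≡ (<⇒<ᵇ v<u) | not-before u v (<⇒≯ v<u) = refl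

  unordered-pairs : ∀ n (f : Fin n → Fin n → ℕ) → (∀ u v → f u v ≡ f v u) →
    ΣΣ n (λ u v → if before u v then 2 * f u v else 0) ≡ ΣΣ n (λ u v → if distinct u v then f u v else 0)
  unordered-pairs n f f-sym = begin
    ΣΣ n (λ u v → if before u v then 2 * f u v else 0)
      ≡⟨ ΣΣ-cong n (λ u v → double (before u v) (f u v)) ⟩
    ΣΣ n (λ u v → below u v + below u v)
      ≡⟨ ΣΣ-+ n below below ⟩
    ΣΣ n below + ΣΣ n below
      ≡⟨ cong (ΣΣ n below +_) transpose ⟩
    ΣΣ n below + ΣΣ n (λ u v → below v u)
      ≡⟨ sym (ΣΣ-+ n below (λ u v → below v u)) ⟩
    ΣΣ n (λ u v → below u v + below v u)
      ≡⟨ ΣΣ-cong n (λ u v → trans (cong (below u v +_) (cong (λ x → if before v u then x else 0) (f-sym v u)))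
                                   (sym (distinct-split u v (f u v)))) ⟩
    ΣΣ n (λ u v → if distinct u v then f u v else 0) ∎
    where
    open ≡-Reasoning
    below : Fin n → Fin n → ℕ
    below u v = if before u v then f u v else 0
    double : ∀ b x → (if b then 2 * x else 0) ≡ (if b then x else 0) + (if b then x else 0)
    double true  x = cong (x +_) (+-identityʳ x)
    double false x = refl
    transpose : ΣΣ n below ≡ ΣΣ n (λ u v → below v u)
    transpose = sumFin-swap n n below

module Labellings where

  open import Defs
  open FiniteSums
  open PairSums
  open Distances using (minDist; dist-≥; dist-adjacent; dist-common)
  open Arithmetic
  open import Data.Nat using (ℕ; suc; _+_; _*_; _∸_; _≤_; z≤n)
  open import Data.Nat.Properties using (+-identityʳ; *-monoʳ-≤; *-zeroʳ; n∸n≡0; m+n≡0⇒m≡0; m+n≡0⇒n≡0; m*n≡0⇒m≡0∨n≡0)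
  open import Data.Nat.Tactic.RingSolver using (solve-∀)
  import Data.Integer as I
  open import Data.Bool using (Bool; true; false; if_then_else_; not; _∧_)
  open import Data.Fin using (Fin; _≟_)
  open import Data.Maybe using (Maybe; just; nothing)
  open import Data.Maybe.Properties using (≡-dec)
  open import Data.Product using (_×_; _,_; ∃-syntax)
  open import Data.Sum using (_⊎_; inj₁; inj₂)
  open import Function using (_∘_)
  open import Relation.Nullary using (yes; no; does; ¬_; contradiction)
  open import Relation.Nullary.Decidable using (dec-true)
  open import Relation.Binary using (DecidableEquality)
  open import Relation.Binary.PropositionalEquality

  -- A labelling of the vertices by `Maybe C`: `nothing` marks a deleted vertex,
  -- `just c` puts the vertex into class c.
  sameClass : ∀ {C : Set} → DecidableEquality C → Maybe C → Maybe C → Bool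
  sameClass _≟C_ nothing  y = false
  sameClass _≟C_ (just c) y = does (≡-dec _≟C_ y (just c))

  sameClass-self : ∀ {C : Set} (_≟C_ : DecidableEquality C) x →
    sameClass _≟C_ x x ≡ not (does (≡-dec _≟C_ x nothing))
  sameClass-self _≟C_ nothing  = refl
  sameClass-self _≟C_ (just c) = dec-true (c ≟C c) refl

  Label : ℕ → Set
  Label k = Maybe (Fin k)

  _≟ℓ_ : ∀ {k} → DecidableEquality (Label k)
  _≟ℓ_ = ≡-dec _≟_

  deleted : ∀ {k} → Label k → Bool
  deleted x = does (x ≟ℓ nothing)

  inClass : ∀ {k} → Fin k → Label k → Bool
  inClass i x = does (x ≟ℓ just i)

  classes-of : ∀ {k} (x : Label k) → sumFin k (λ i → χ (inClass i x)) ≡ χ (not (deleted x))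
  classes-of {k} (just j) = sumFin-delta k j (λ _ → 1)
  classes-of {k} nothing  = sumFin-zero k

  sameClass-sum : ∀ {k} (x y : Label k) →
    sumFin k (λ i → χ (inClass i x) * χ (inClass i y)) ≡ χ (sameClass _≟_ x y)
  sameClass-sum {k} (just j) y =
    trans (sumFin-cong k (λ i → indicator-* (does (j ≟ i)) (χ (inClass i y))))
          (sumFin-delta k j (λ i → χ (inClass i y)))
    where
    indicator-* : ∀ b z → χ b * z ≡ (if b then z else 0)
    indicator-* true  z = +-identityʳ z
    indicator-* false z = refl
  sameClass-sum {k} nothing y = sumFin-zero k

  module LabelledGraph {n k : ℕ} (G : Adj n) (G-sym : ∀ u v → G u v ≡ G v u)
    (ℓ : Fin n → Label k) (proper : ∀ u v → sameClass _≟_ (ℓ u) (ℓ v) ≡ true → G u v ≡ false)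
    (s : ℕ) where

    classSize : Fin k → ℕ
    classSize i = sumFin n (λ u → χ (inClass i (ℓ u)))

    nDeleted nLabelled sumSquares : ℕ
    nDeleted   = sumFin n (λ u → χ (deleted (ℓ u)))
    nLabelled  = sumFin k classSize
    sumSquares = sumFin k (λ i → classSize i * classSize i)

    distinctPairs nonEdges sameClassPairs : ℕ
    distinctPairs  = ΣΣ n (λ u v → if distinct u v then 1 else 0)
    nonEdges       = ΣΣ n (λ u v → if distinct u v then χ (not (G u v)) else 0)
    sameClassPairs = ΣΣ n (λ u v → if distinct u v then χ (sameClass _≟_ (ℓ u) (ℓ v)) else 0)

    -- The three sources of slack in the bound: distances above their trivial
    -- lower bound, non-adjacent pairs lying in different classes, and the
    -- deviation of the class sizes from s and s + 1.
    distExcess missingEdges imbalance : ℕ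
    distExcess   = ΣΣ n (λ u v → (if before u v then 2 * dist G u v else 0)
                               ∸ (if before u v then 2 * minDist G u v else 0))
    missingEdges = ΣΣ n (λ u v → if distinct u v then χ (not (G u v) ∧ not (sameClass _≟_ (ℓ u) (ℓ v))) else 0)
    imbalance    = sumFin k (λ i → parabola (classSize i) s ∸ secant (classSize i) s)

    -- 2W counts distances over ordered pairs; subtracting the trivial bound
    -- minDist = 1 + [non-adjacent] leaves the distance excess.
    twice-wiener : 2 * wiener G ≡ distinctPairs + nonEdges + distExcess
    twice-wiener = begin
      2 * wiener G
        ≡⟨ sym (sumFin-* n 2 _) ⟩
      sumFin n (λ u → 2 * sumFin n (λ v → if before u v then dist G u v else 0))
        ≡⟨ sumFin-cong n (λ u → trans (sym (sumFin-* n 2 _)) (sumFin-cong n (λ v → double (before u v) (dist G u v)))) ⟩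
      ΣΣ n (λ u v → if before u v then 2 * dist G u v else 0)
        ≡⟨ ΣΣ-slack n _ _ trivial≤ ⟩
      ΣΣ n (λ u v → if before u v then 2 * minDist G u v else 0) + distExcess
        ≡⟨ cong (_+ distExcess) (trans (ΣΣ-cong n split-minDist) (ΣΣ-+ n _ _)) ⟩
      ΣΣ n (λ u v → if before u v then 2 * 1 else 0)
        + ΣΣ n (λ u v → if before u v then 2 * χ (not (G u v)) else 0) + distExcess
        ≡⟨ cong (_+ distExcess) (cong₂ _+_ (unordered-pairs n (λ _ _ → 1) (λ _ _ → refl))
                                           (unordered-pairs n (λ u v → χ (not (G u v))) (λ u v → cong (χ ∘ not) (G-sym u v)))) ⟩
      distinctPairs + nonEdges + distExcess ∎
      where
      open ≡-Reasoning
      double : ∀ b x → 2 * (if b then x else 0) ≡ (if b then 2 * x else 0)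
      double true  x = refl
      double false x = refl
      trivial≤ : ∀ u v → (if before u v then 2 * minDist G u v else 0) ≤ (if before u v then 2 * dist G u v else 0)
      trivial≤ u v with before u v in b
      ... | true  = *-monoʳ-≤ 2 (dist-≥ G u v (before⇒≢ u v b))
      ... | false = z≤n
      split-minDist : ∀ u v → (if before u v then 2 * minDist G u v else 0)
        ≡ (if before u v then 2 * 1 else 0) + (if before u v then 2 * χ (not (G u v)) else 0)
      split-minDist u v with before u v | G u v
      ... | true  | true  = refl
      ... | true  | false = refl
      ... | false | _     = refl

    distinctPairs-count : distinctPairs + n ≡ n * n
    distinctPairs-count = begin
      distinctPairs + n                 ≡⟨ cong (distinctPairs +_) (sym (sumFin-one n)) ⟩
      distinctPairs + sumFin n (λ _ → 1) ≡⟨ sym (sumFin-+ n _ _) ⟩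
      sumFin n (λ u → sumFin n (λ v → if distinct u v then 1 else 0) + 1) ≡⟨ sumFin-cong n row ⟩
      sumFin n (λ _ → n)                ≡⟨ sumFin-const n n ⟩
      n * n                             ∎
      where
      open ≡-Reasoning
      complement : ∀ b → (if not b then 1 else 0) + (if b then 1 else 0) ≡ 1
      complement true  = refl
      complement false = refl
      row : ∀ u → sumFin n (λ v → if distinct u v then 1 else 0) + 1 ≡ n
      row u = begin
        sumFin n (λ v → if distinct u v then 1 else 0) + 1
          ≡⟨ cong (sumFin n (λ v → if distinct u v then 1 else 0) +_) (sym (sumFin-delta n u (λ _ → 1))) ⟩
        sumFin n (λ v → if distinct u v then 1 else 0) + sumFin n (λ v → if does (u ≟ v) then 1 else 0)
          ≡⟨ sym (sumFin-+ n _ _) ⟩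
        sumFin n (λ v → (if distinct u v then 1 else 0) + (if does (u ≟ v) then 1 else 0))
          ≡⟨ trans (sumFin-cong n (λ v → complement (does (u ≟ v)))) (sumFin-one n) ⟩
        n ∎

    -- By properness, every pair in a common class is a non-edge.
    nonEdges-split : nonEdges ≡ sameClassPairs + missingEdges
    nonEdges-split = trans (ΣΣ-cong n split) (ΣΣ-+ n _ _)
      where
      split : ∀ u v → (if distinct u v then χ (not (G u v)) else 0)
        ≡ (if distinct u v then χ (sameClass _≟_ (ℓ u) (ℓ v)) else 0)
          + (if distinct u v then χ (not (G u v) ∧ not (sameClass _≟_ (ℓ u) (ℓ v))) else 0)
      split u v with distinct u v | sameClass _≟_ (ℓ u) (ℓ v) in same
      ... | false | _    = refl
      ... | true  | true rewrite proper u v same = refl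
      ... | true  | false with G u v
      ...   | true  = refl
      ...   | false = refl

    labelled-count : sumFin n (λ u → χ (not (deleted (ℓ u)))) ≡ nLabelled
    labelled-count = trans (sumFin-cong n (λ u → sym (classes-of (ℓ u))))
                           (sumFin-swap n k (λ u i → χ (inClass i (ℓ u))))

    deleted+labelled : nDeleted + nLabelled ≡ n
    deleted+labelled = begin
      nDeleted + nLabelled ≡⟨ cong (nDeleted +_) (sym labelled-count) ⟩
      nDeleted + sumFin n (λ u → χ (not (deleted (ℓ u)))) ≡⟨ sym (sumFin-+ n _ _) ⟩
      sumFin n (λ u → χ (deleted (ℓ u)) + χ (not (deleted (ℓ u)))) ≡⟨ sumFin-cong n (λ u → complement (deleted (ℓ u))) ⟩
      sumFin n (λ _ → 1) ≡⟨ sumFin-one n ⟩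
      n ∎
      where
      open ≡-Reasoning
      complement : ∀ b → χ b + χ (not b) ≡ 1
      complement true  = refl
      complement false = refl

    -- Ordered pairs in a common class, together with the diagonal pairs (u, u)
    -- of labelled vertices, are counted by the squares of the class sizes.
    sameClassPairs-count : sameClassPairs + nLabelled ≡ sumSquares
    sameClassPairs-count = begin
      sameClassPairs + nLabelled
        ≡⟨ cong (sameClassPairs +_) (sym (trans (sumFin-cong n diagonal) labelled-count)) ⟩
      sameClassPairs + ΣΣ n (λ u v → if does (u ≟ v) then χ (sameClass _≟_ (ℓ u) (ℓ v)) else 0)
        ≡⟨ sym (ΣΣ-+ n _ _) ⟩
      ΣΣ n (λ u v → (if distinct u v then χ (sameClass _≟_ (ℓ u) (ℓ v)) else 0)
                    + (if does (u ≟ v) then χ (sameClass _≟_ (ℓ u) (ℓ v)) else 0))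
        ≡⟨ ΣΣ-cong n (λ u v → recombine (does (u ≟ v)) (χ (sameClass _≟_ (ℓ u) (ℓ v)))) ⟩
      ΣΣ n (λ u v → χ (sameClass _≟_ (ℓ u) (ℓ v)))
        ≡⟨ ΣΣ-cong n (λ u v → sym (sameClass-sum (ℓ u) (ℓ v))) ⟩
      ΣΣ n (λ u v → sumFin k (λ i → χ (inClass i (ℓ u)) * χ (inClass i (ℓ v))))
        ≡⟨ sumFin-cong n (λ u → sumFin-swap n k _) ⟩
      sumFin n (λ u → sumFin k (λ i → sumFin n (λ v → χ (inClass i (ℓ u)) * χ (inClass i (ℓ v)))))
        ≡⟨ sumFin-swap n k _ ⟩
      sumFin k (λ i → ΣΣ n (λ u v → χ (inClass i (ℓ u)) * χ (inClass i (ℓ v))))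
        ≡⟨ sumFin-cong k (λ i → sumFin-product n _ _) ⟩
      sumSquares ∎
      where
      open ≡-Reasoning
      diagonal : ∀ u → sumFin n (λ v → if does (u ≟ v) then χ (sameClass _≟_ (ℓ u) (ℓ v)) else 0)
                       ≡ χ (not (deleted (ℓ u)))
      diagonal u = trans (sumFin-delta n u (λ v → χ (sameClass _≟_ (ℓ u) (ℓ v))))
                         (cong χ (sameClass-self _≟_ (ℓ u)))
      recombine : ∀ b x → (if not b then x else 0) + (if b then x else 0) ≡ x
      recombine true  x = refl
      recombine false x = +-identityʳ x

    pairs-identity : 2 * wiener G + n + nLabelled ≡ n * n + sumSquares + distExcess + missingEdges
    pairs-identity = begin
      2 * wiener G + n + nLabelled
        ≡⟨ cong (λ x → x + n + nLabelled) (trans twice-wiener (cong (λ x → distinctPairs + x + distExcess) nonEdges-split)) ⟩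
      distinctPairs + (sameClassPairs + missingEdges) + distExcess + n + nLabelled
        ≡⟨ regroup distinctPairs sameClassPairs missingEdges distExcess n nLabelled ⟩
      (distinctPairs + n) + (sameClassPairs + nLabelled) + distExcess + missingEdges
        ≡⟨ cong₂ (λ x y → x + y + distExcess + missingEdges) distinctPairs-count sameClassPairs-count ⟩
      n * n + sumSquares + distExcess + missingEdges ∎
      where
      open ≡-Reasoning
      regroup : ∀ a b c d e f → a + (b + c) + d + e + f ≡ (a + e) + (b + f) + d + c
      regroup = solve-∀

    classes-identity : sumSquares + k * (s * suc s) ≡ (2 * s + 1) * nLabelled + imbalance
    classes-identity = begin
      sumSquares + k * (s * suc s)            ≡⟨ cong (sumSquares +_) (sym (sumFin-const k (s * suc s))) ⟩
      sumSquares + sumFin k (λ _ → s * suc s) ≡⟨ sym (sumFin-+ k _ _) ⟩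
      sumFin k (λ i → parabola (classSize i) s)
        ≡⟨ sumFin-slack k _ _ (λ i → secant≤parabola (classSize i) s) ⟩
      sumFin k (λ i → secant (classSize i) s) + imbalance ≡⟨ cong (_+ imbalance) (sumFin-* k (2 * s + 1) classSize) ⟩
      (2 * s + 1) * nLabelled + imbalance     ∎
      where open ≡-Reasoning

    excess : ℕ → ℕ
    excess m = distExcess + missingEdges + imbalance + 2 * s * (m ∸ nDeleted)

    wiener-excess : ∀ t m → n ≡ (s * k + t) + m → nDeleted ≤ m →
      I.+ (2 * wiener G) ≡ wienerBound n m s t I.+ I.+ excess m
    wiener-excess t m = bound-from-counting k s t m
      pairs-identity classes-identity deleted+labelled

    missingEdges≡0⇒ : missingEdges ≡ 0 →
      ∀ u v → ¬ u ≡ v → G u v ≡ false → sameClass _≟_ (ℓ u) (ℓ v) ≡ true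
    missingEdges≡0⇒ h u v u≢v uv with ΣΣ-0⇒ n _ h u v
    ... | term rewrite ≢⇒distinct u≢v | uv with sameClass _≟_ (ℓ u) (ℓ v)
    ...   | true  = refl
    ...   | false = contradiction term λ ()

    ⇒missingEdges≡0 : (∀ u v → ¬ u ≡ v → G u v ≡ false → sameClass _≟_ (ℓ u) (ℓ v) ≡ true) →
      missingEdges ≡ 0
    ⇒missingEdges≡0 h = ⇒ΣΣ-0 n _ term
      where
      term : ∀ u v → (if distinct u v then χ (not (G u v) ∧ not (sameClass _≟_ (ℓ u) (ℓ v))) else 0) ≡ 0
      term u v with u ≟ v
      ... | yes _ = refl
      ... | no u≢v with G u v in uv
      ...   | true  = refl
      ...   | false rewrite h u v u≢v uv = refl

    imbalance≡0⇒ : imbalance ≡ 0 → ∀ i → classSize i ≡ s ⊎ classSize i ≡ suc s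
    imbalance≡0⇒ h i = secant≡parabola⇒ (classSize i) s (sumFin-0⇒ k _ h i)

    ⇒imbalance≡0 : (∀ i → classSize i ≡ s ⊎ classSize i ≡ suc s) → imbalance ≡ 0
    ⇒imbalance≡0 h = ⇒sumFin-0 k _ (λ i → ⇒secant≡parabola (classSize i) s (h i))

    ⇒distExcess≡0 : (∀ u v → ¬ u ≡ v → G u v ≡ false → ∃[ w ] (G u w ≡ true × G w v ≡ true)) →
      distExcess ≡ 0
    ⇒distExcess≡0 h = ⇒ΣΣ-0 n _ term
      where
      term : ∀ u v → (if before u v then 2 * dist G u v else 0) ∸ (if before u v then 2 * minDist G u v else 0) ≡ 0
      term u v with before u v in b
      ... | false = refl
      ... | true with G u v in uv
      ...   | true rewrite dist-adjacent G u v (before⇒≢ u v b) uv = refl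
      ...   | false with h u v (before⇒≢ u v b) uv
      ...     | w , uw , wv rewrite dist-common G u w v (before⇒≢ u v b) uv uw wv = refl

    excess≡0⇒ : ∀ m → ¬ s ≡ 0 → excess m ≡ 0 →
      missingEdges ≡ 0 × imbalance ≡ 0 × m ∸ nDeleted ≡ 0
    excess≡0⇒ m s≢0 h = m+n≡0⇒n≡0 distExcess (m+n≡0⇒m≡0 _ first-three) ,
                        m+n≡0⇒n≡0 (distExcess + missingEdges) first-three ,
                        unused-deletions
      where
      first-three : distExcess + missingEdges + imbalance ≡ 0
      first-three = m+n≡0⇒m≡0 _ h
      unused-deletions : m ∸ nDeleted ≡ 0
      unused-deletions with m*n≡0⇒m≡0∨n≡0 (2 * s) (m+n≡0⇒n≡0 (distExcess + missingEdges + imbalance) h)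
      ... | inj₂ e = e
      ... | inj₁ e = contradiction (m+n≡0⇒m≡0 s e) s≢0

    ⇒excess≡0 : ∀ m → distExcess ≡ 0 → missingEdges ≡ 0 → imbalance ≡ 0 → nDeleted ≡ m → excess m ≡ 0
    ⇒excess≡0 m d₀ e₀ i₀ refl rewrite d₀ | e₀ | i₀ | n∸n≡0 nDeleted = *-zeroʳ (2 * s)

module Counting where

  open import Defs
  open FiniteSums
  open import Data.Nat using (zero; suc; _<_)
  open import Data.Bool using (Bool; true; false; T; not)
  import Data.Bool.Properties as Bool
  open import Data.Bool.Properties using (T-irrelevant)
  open import Data.Fin using (Fin)
  open import Data.Fin.Properties using (0↔⊥; 1↔⊤; +↔⊎)
  open import Data.Fin.Permutation using (↔⇒≡)
  open import Data.Sum using (_⊎_; inj₁; inj₂)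
  open import Data.Sum.Function.Propositional using (_⊎-↔_)
  open import Data.Product using (Σ; _,_; proj₁)
  open import Data.Product.Function.Dependent.Propositional using (Σ-↔)
  open import Function using (_∘_)
  open import Function.Bundles using (_↔_; Inverse; mk↔ₛ′)
  open import Function.Properties.Inverse using (↔-sym; ↔-trans; ↔-refl)
  open import Relation.Binary using (DecidableEquality)
  open import Relation.Nullary using (Dec; yes; no; does)
  open import Relation.Binary.PropositionalEquality
  open import Axiom.UniquenessOfIdentityProofs using (module Decidable⇒UIP)

  Σ-Fin-suc : ∀ n (p : Fin (suc n) → Bool) →
    Σ (Fin (suc n)) (T ∘ p) ↔ (T (p Fin.zero) ⊎ Σ (Fin n) (T ∘ p ∘ Fin.suc))
  Σ-Fin-suc n p = mk↔ₛ′ split merge split∘merge merge∘split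
    where
    split : Σ (Fin (suc n)) (T ∘ p) → T (p Fin.zero) ⊎ Σ (Fin n) (T ∘ p ∘ Fin.suc)
    split (Fin.zero  , h) = inj₁ h
    split (Fin.suc u , h) = inj₂ (u , h)
    merge : T (p Fin.zero) ⊎ Σ (Fin n) (T ∘ p ∘ Fin.suc) → Σ (Fin (suc n)) (T ∘ p)
    merge (inj₁ h)       = Fin.zero , h
    merge (inj₂ (u , h)) = Fin.suc u , h
    split∘merge : ∀ y → split (merge y) ≡ y
    split∘merge (inj₁ _)     = refl
    split∘merge (inj₂ (_ , _)) = refl
    merge∘split : ∀ x → merge (split x) ≡ x
    merge∘split (Fin.zero  , _) = refl
    merge∘split (Fin.suc _ , _) = refl

  T↔Fin-χ : ∀ b → T b ↔ Fin (χ b)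
  T↔Fin-χ true  = ↔-sym 1↔⊤
  T↔Fin-χ false = ↔-sym 0↔⊥

  satisfying↔ : ∀ n (p : Fin n → Bool) → Σ (Fin n) (T ∘ p) ↔ Fin (sumFin n (χ ∘ p))
  satisfying↔ zero    p = mk↔ₛ′ (λ { (() , _) }) (λ ()) (λ ()) (λ { (() , _) })
  satisfying↔ (suc n) p = ↔-trans (Σ-Fin-suc n p)
    (↔-trans (T↔Fin-χ (p Fin.zero) ⊎-↔ satisfying↔ n (p ∘ Fin.suc)) (↔-sym +↔⊎))

  count-↔ : ∀ {n N} (f : Fin n ↔ Fin N) (p : Fin N → Bool) →
    sumFin n (λ u → χ (p (Inverse.to f u))) ≡ sumFin N (χ ∘ p)
  count-↔ {n} {N} f p = ↔⇒≡ (↔-trans (↔-sym (satisfying↔ n (p ∘ Inverse.to f)))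
    (↔-trans (Σ-↔ {B = T ∘ p} f ↔-refl) (satisfying↔ N p)))

  Fibre : ∀ {n} {L : Set} → (Fin n → L) → L → Set
  Fibre {n} ℓ l = Σ (Fin n) (λ u → ℓ u ≡ l)

  fibres↔ : ∀ {n} {L : Set} (ℓ : Fin n → L) → Fin n ↔ Σ L (Fibre ℓ)
  fibres↔ ℓ = mk↔ₛ′ (λ u → ℓ u , u , refl) (λ { (_ , u , _) → u }) inverse (λ _ → refl)
    where
    inverse : ∀ p → (ℓ _ , _ , refl) ≡ p
    inverse (_ , u , refl) = refl

  does-sound : ∀ {A : Set} (d : Dec A) → T (does d) → A
  does-sound (yes a) _ = a

  does-complete : ∀ {A : Set} (d : Dec A) → A → T (does d)
  does-complete (yes _) _ = _
  does-complete (no ¬a) a = ¬a a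

  χ-positive : ∀ {b} → 0 < χ b → T b
  χ-positive {true} _ = _

  fibre↔ : ∀ {n} {L : Set} (_≟L_ : DecidableEquality L) (ℓ : Fin n → L) l →
    Fibre ℓ l ↔ Fin (sumFin n (λ u → χ (does (ℓ u ≟L l))))
  fibre↔ {n} _≟L_ ℓ l =
    ↔-trans (Σ-↔ ↔-refl (mk↔ₛ′ (does-complete (ℓ _ ≟L l)) (does-sound (ℓ _ ≟L l)) T-unique ≡-unique))
            (satisfying↔ n (λ u → does (ℓ u ≟L l)))
    where
    open Decidable⇒UIP _≟L_ using (≡-irrelevant)
    T-unique : ∀ {u} (h : T (does (ℓ u ≟L l))) → does-complete (ℓ u ≟L l) (does-sound (ℓ u ≟L l) h) ≡ h
    T-unique _ = T-irrelevant _ _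
    ≡-unique : ∀ {u} (e : ℓ u ≡ l) → does-sound (ℓ u ≟L l) (does-complete (ℓ u ≟L l) e) ≡ e
    ≡-unique _ = ≡-irrelevant _ _

  ↔-Fin : ∀ {a b} → a ≡ b → Fin a ↔ Fin b
  ↔-Fin refl = ↔-refl

  Σ-Bool↔ : ∀ {P : Bool → Set} → Σ Bool P ↔ (P true ⊎ P false)
  Σ-Bool↔ {P} = mk↔ₛ′ split merge split∘merge merge∘split
    where
    split : Σ Bool P → P true ⊎ P false
    split (true  , p) = inj₁ p
    split (false , p) = inj₂ p
    merge : P true ⊎ P false → Σ Bool P
    merge (inj₁ p) = true  , p
    merge (inj₂ p) = false , p
    split∘merge : ∀ y → split (merge y) ≡ y
    split∘merge (inj₁ _) = refl
    split∘merge (inj₂ _) = refl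
    merge∘split : ∀ x → merge (split x) ≡ x
    merge∘split (true  , _) = refl
    merge∘split (false , _) = refl

  isInj₁ : ∀ {A B : Set} → A ⊎ B → Bool
  isInj₁ (inj₁ _) = true
  isInj₁ (inj₂ _) = false

  partition↔ : ∀ k (q : Fin k → Bool) →
    Σ (Fin k ↔ (Fin (sumFin k (χ ∘ q)) ⊎ Fin (sumFin k (χ ∘ not ∘ q)))) λ π →
      ∀ i → isInj₁ (Inverse.to π i) ≡ q i
  partition↔ k q = π , sides
    where
    holds : sumFin k (λ i → χ (does (q i Bool.≟ true))) ≡ sumFin k (χ ∘ q)
    holds = sumFin-cong k (λ i → cong χ (≟true (q i)))
      where
      ≟true : ∀ b → does (b Bool.≟ true) ≡ b
      ≟true true  = refl
      ≟true false = refl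
    fails : sumFin k (λ i → χ (does (q i Bool.≟ false))) ≡ sumFin k (χ ∘ not ∘ q)
    fails = sumFin-cong k (λ i → cong χ (≟false (q i)))
      where
      ≟false : ∀ b → does (b Bool.≟ false) ≡ not b
      ≟false true  = refl
      ≟false false = refl
    on-sides : (Fibre q true ⊎ Fibre q false) ↔ (Fin (sumFin k (χ ∘ q)) ⊎ Fin (sumFin k (χ ∘ not ∘ q)))
    on-sides = ↔-trans (fibre↔ Bool._≟_ q true) (↔-Fin holds) ⊎-↔ ↔-trans (fibre↔ Bool._≟_ q false) (↔-Fin fails)
    π : Fin k ↔ (Fin (sumFin k (χ ∘ q)) ⊎ Fin (sumFin k (χ ∘ not ∘ q)))
    π = ↔-trans (fibres↔ q) (↔-trans (Σ-Bool↔ {Fibre q}) on-sides)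
    sides : ∀ i → isInj₁ (Inverse.to π i) ≡ q i
    sides i = trans (on-sides-side (Inverse.to (Σ-Bool↔ {Fibre q}) (q i , i , refl))) (Σ-Bool-side (q i , i , refl))
      where
      on-sides-side : ∀ y → isInj₁ (Inverse.to on-sides y) ≡ isInj₁ y
      on-sides-side (inj₁ _) = refl
      on-sides-side (inj₂ _) = refl
      Σ-Bool-side : ∀ (x : Σ Bool (Fibre q)) → isInj₁ (Inverse.to (Σ-Bool↔ {Fibre q}) x) ≡ proj₁ x
      Σ-Bool-side (true  , _) = refl
      Σ-Bool-side (false , _) = refl

module MultipartiteGraphs where

  open import Defs
  open FiniteSums
  open Counting
  open Labellings using (sameClass)
  open import Data.Nat using (ℕ)
  open import Data.Bool using (true; false; not)
  open import Data.Fin using (Fin; _≟_)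
  open import Data.Maybe using (Maybe; just; nothing)
  import Data.Maybe as Maybe
  open import Data.Maybe.Properties using (≡-dec)
  open import Data.Product using (_×_; _,_; Σ; ∃-syntax; proj₁; proj₂)
  open import Data.Product.Function.Dependent.Propositional using (Σ-↔)
  open import Function.Bundles using (_↔_; Inverse; mk↔ₛ′)
  open import Function.Properties.Inverse using (↔-sym; ↔-trans)
  open import Relation.Nullary using (yes; no; does; ¬_; contradiction)
  open import Relation.Nullary.Decidable using (dec-true; dec-false)
  open import Relation.Binary using (DecidableEquality)
  open import Relation.Binary.PropositionalEquality

  open Inverse using (to; from; strictlyInverseˡ; strictlyInverseʳ)

  ↔-injective : ∀ {A B : Set} (f : A ↔ B) {x y} → to f x ≡ to f y → x ≡ y
  ↔-injective f {x} {y} e = trans (sym (strictlyInverseʳ f x)) (trans (cong (from f) e) (strictlyInverseʳ f y))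

  ↔-Maybe : ∀ {A B : Set} → A ↔ B → Maybe A ↔ Maybe B
  ↔-Maybe f = mk↔ₛ′ (Maybe.map (to f)) (Maybe.map (from f)) to∘from from∘to
    where
    to∘from : ∀ y → Maybe.map (to f) (Maybe.map (from f) y) ≡ y
    to∘from nothing  = refl
    to∘from (just y) = cong just (strictlyInverseˡ f y)
    from∘to : ∀ x → Maybe.map (from f) (Maybe.map (to f) x) ≡ x
    from∘to nothing  = refl
    from∘to (just x) = cong just (strictlyInverseʳ f x)

  labelCount : ∀ {n} {C : Set} → DecidableEquality C → (Fin n → Maybe C) → Maybe C → ℕ
  labelCount {n} _≟C_ ℓ l = sumFin n (λ u → χ (does (≡-dec _≟C_ (ℓ u) l)))

  -- A graph is complete multipartite by ℓ (with the deleted vertices forming a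
  -- clique joined to everything) when it is loopless and distinct vertices are
  -- adjacent exactly when they do not share a class.
  MultipartiteBy : ∀ {n} {C : Set} → DecidableEquality C → Adj n → (Fin n → Maybe C) → Set
  MultipartiteBy {n} _≟C_ A ℓ =
    (∀ u → A u u ≡ false) × (∀ (u v : Fin n) → ¬ u ≡ v → A u v ≡ not (sameClass _≟C_ (ℓ u) (ℓ v)))

  does-↔ : ∀ {A B : Set} (_≟A_ : DecidableEquality A) (_≟B_ : DecidableEquality B) (f : A ↔ B) x y →
    does (to f x ≟B to f y) ≡ does (x ≟A y)
  does-↔ _≟A_ _≟B_ f x y with x ≟A y
  ... | yes refl = dec-true (to f x ≟B to f x) refl
  ... | no x≢y   = dec-false (to f x ≟B to f y) (λ e → x≢y (↔-injective f e))

  sameClass-↔ : ∀ {C C′ : Set} (_≟C_ : DecidableEquality C) (_≟C′_ : DecidableEquality C′)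
    (π : C ↔ C′) x y →
    sameClass _≟C′_ (to (↔-Maybe π) x) (to (↔-Maybe π) y) ≡ sameClass _≟C_ x y
  sameClass-↔ _≟C_ _≟C′_ π nothing  y = refl
  sameClass-↔ _≟C_ _≟C′_ π (just c) y = does-↔ (≡-dec _≟C_) (≡-dec _≟C′_) (↔-Maybe π) y (just c)

  multipartite-iso : ∀ {n N} {C C′ : Set} (_≟C_ : DecidableEquality C) (_≟C′_ : DecidableEquality C′)
    (A : Adj n) (B : Adj N) (ℓA : Fin n → Maybe C) (ℓB : Fin N → Maybe C′) (π : C ↔ C′) →
    MultipartiteBy _≟C_ A ℓA → MultipartiteBy _≟C′_ B ℓB →
    (∀ l → labelCount _≟C_ ℓA l ≡ labelCount _≟C′_ ℓB (to (↔-Maybe π) l)) → A ≅ B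
  multipartite-iso {n} {N} {C} {C′} _≟C_ _≟C′_ A B ℓA ℓB π (A-loopless , A-by) (B-loopless , B-by) sizes =
    φ , preserves
    where
    σ : Maybe C ↔ Maybe C′
    σ = ↔-Maybe π

    -- Corresponding fibres have the same size, so the vertex sets, viewed as
    -- disjoint unions of fibres, are in bijection over σ.
    matched : ∀ l → Fibre ℓA l ↔ Fibre ℓB (to σ l)
    matched l = ↔-trans (fibre↔ (≡-dec _≟C_) ℓA l)
                (↔-trans (↔-Fin (sizes l)) (↔-sym (fibre↔ (≡-dec _≟C′_) ℓB (to σ l))))

    relabel : Σ (Maybe C) (Fibre ℓA) ↔ Σ (Maybe C′) (Fibre ℓB)
    relabel = Σ-↔ σ (λ {l} → matched l)

    φ : Fin n ↔ Fin N
    φ = ↔-trans (fibres↔ ℓA) (↔-trans relabel (↔-sym (fibres↔ ℓB)))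

    label-φ : ∀ u → ℓB (to φ u) ≡ to σ (ℓA u)
    label-φ u = proj₂ (proj₂ (to relabel (ℓA u , u , refl)))

    preserves : ∀ u v → A u v ≡ B (to φ u) (to φ v)
    preserves u v with u ≟ v
    ... | yes refl = trans (A-loopless u) (sym (B-loopless (to φ u)))
    ... | no u≢v = begin
      A u v                                                 ≡⟨ A-by u v u≢v ⟩
      not (sameClass _≟C_ (ℓA u) (ℓA v))                    ≡⟨ cong not (sym (sameClass-↔ _≟C_ _≟C′_ π (ℓA u) (ℓA v))) ⟩
      not (sameClass _≟C′_ (to σ (ℓA u)) (to σ (ℓA v)))     ≡⟨ cong₂ (λ x y → not (sameClass _≟C′_ x y)) (sym (label-φ u)) (sym (label-φ v)) ⟩
      not (sameClass _≟C′_ (ℓB (to φ u)) (ℓB (to φ v)))     ≡⟨ sym (B-by (to φ u) (to φ v) (λ e → u≢v (↔-injective φ e))) ⟩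
      B (to φ u) (to φ v)                                   ∎
      where open ≡-Reasoning

  module _ {n : ℕ} {C : Set} (_≟C_ : DecidableEquality C) (A : Adj n) (ℓ : Fin n → Maybe C) where

    multipartite-intro : (∀ u → A u u ≡ false) →
      (∀ u v → sameClass _≟C_ (ℓ u) (ℓ v) ≡ true → A u v ≡ false) →
      (∀ u v → ¬ u ≡ v → A u v ≡ false → sameClass _≟C_ (ℓ u) (ℓ v) ≡ true) →
      MultipartiteBy _≟C_ A ℓ
    multipartite-intro loopless independent complete = loopless , by-class
      where
      by-class : ∀ u v → ¬ u ≡ v → A u v ≡ not (sameClass _≟C_ (ℓ u) (ℓ v))
      by-class u v u≢v with sameClass _≟C_ (ℓ u) (ℓ v) in same
      ... | true = independent u v same
      ... | false with A u v in uv
      ...   | true  = refl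
      ...   | false = contradiction (trans (sym same) (complete u v u≢v uv)) λ ()

    module _ (multipartite : MultipartiteBy _≟C_ A ℓ) where

      private
        loopless : ∀ u → A u u ≡ false
        loopless = proj₁ multipartite
        by-class : ∀ u v → ¬ u ≡ v → A u v ≡ not (sameClass _≟C_ (ℓ u) (ℓ v))
        by-class = proj₂ multipartite

      multipartite-independent : ∀ u v → sameClass _≟C_ (ℓ u) (ℓ v) ≡ true → A u v ≡ false
      multipartite-independent u v same with u ≟ v
      ... | yes refl = loopless u
      ... | no u≢v   = trans (by-class u v u≢v) (cong not same)

      multipartite-complete : ∀ u v → ¬ u ≡ v → A u v ≡ false → sameClass _≟C_ (ℓ u) (ℓ v) ≡ true
      multipartite-complete u v u≢v uv with sameClass _≟C_ (ℓ u) (ℓ v) in same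
      ... | true  = refl
      ... | false = contradiction (trans (sym uv) (trans (by-class u v u≢v) (cong not same))) λ ()

      multipartite-common : ∀ w → ℓ w ≡ nothing →
        ∀ u v → ¬ u ≡ v → A u v ≡ false → ∃[ w′ ] (A u w′ ≡ true × A w′ v ≡ true)
      multipartite-common w deleted u v u≢v uv = w , uw , wv
        where
        same : sameClass _≟C_ (ℓ u) (ℓ v) ≡ true
        same = multipartite-complete u v u≢v uv
        outside : ∀ x → sameClass _≟C_ (ℓ x) nothing ≡ false
        outside x with ℓ x
        ... | nothing = refl
        ... | just _  = refl
        u≢w : ¬ u ≡ w
        u≢w refl = contradiction (trans (sym same) (cong (λ x → sameClass _≟C_ x (ℓ v)) deleted)) λ ()
        v≢w : ¬ v ≡ w
        v≢w refl = contradiction (trans (sym same) (trans (cong (sameClass _≟C_ (ℓ u)) deleted) (outside u))) λ ()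
        uw : A u w ≡ true
        uw = trans (by-class u w u≢w) (cong not (trans (cong (sameClass _≟C_ (ℓ u)) deleted) (outside u)))
        wv : A w v ≡ true
        wv = trans (by-class w v (λ e → v≢w (sym e))) (cong (λ x → not (sameClass _≟C_ x (ℓ v))) deleted)

module ExtremalGraphs where

  open import Defs
  open FiniteSums
  open Distances using (≟-refl; ≟-≢)
  open Labellings using (sameClass)
  open MultipartiteGraphs using (MultipartiteBy; labelCount)
  open import Data.Nat using (ℕ; suc; _+_; _*_)
  open import Data.Nat.Properties using (+-identityʳ)
  open import Data.Bool using (false; not)
  open import Data.Fin using (Fin; _≟_; splitAt; _↑ˡ_; _↑ʳ_)
  open import Data.Fin.Properties using (splitAt-↑ˡ; splitAt-↑ʳ; splitAt⁻¹-↑ˡ)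
  open import Data.Maybe using (Maybe; just; nothing)
  open import Data.Sum using (_⊎_; inj₁; inj₂; [_,_])
  import Data.Sum.Properties as Sum
  open import Data.Product using (_,_)
  open import Function using (_∘_)
  open import Relation.Nullary using (does; ¬_)
  open import Relation.Nullary.Decidable using (dec-true)
  open import Data.Maybe.Properties using (≡-dec)
  open import Relation.Binary using (DecidableEquality)
  open import Relation.Binary.PropositionalEquality hiding ([_])

  part : ∀ c r → Fin (c * r) → Fin c
  part (suc c) r x = [ (λ _ → Fin.zero) , (λ y → Fin.suc (part c r y)) ] (splitAt r x)

  joinCopies-by-part : ∀ c r x y → joinCopies c r x y ≡ not (does (part c r y ≟ part c r x))
  joinCopies-by-part (suc c) r x y with splitAt r x | splitAt r y
  ... | inj₁ _ | inj₁ _ = refl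
  ... | inj₁ _ | inj₂ _ = refl
  ... | inj₂ _ | inj₁ _ = refl
  ... | inj₂ a | inj₂ b = joinCopies-by-part c r a b

  part-count : ∀ c r (j : Fin c) → sumFin (c * r) (λ z → χ (does (part c r z ≟ j))) ≡ r
  part-count (suc c) r j = trans (sumFin-++ r (c * r) _) (by-part j)
    where
    first : ∀ i → part (suc c) r (i ↑ˡ c * r) ≡ Fin.zero
    first i rewrite splitAt-↑ˡ r i (c * r) = refl
    rest : ∀ i → part (suc c) r (r ↑ʳ i) ≡ Fin.suc (part c r i)
    rest i rewrite splitAt-↑ʳ r (c * r) i = refl
    count-blocks : ∀ j → sumFin (c * r) (λ i → χ (does (part (suc c) r (r ↑ʳ i) ≟ j)))
                       ≡ sumFin (c * r) (λ i → χ (does (Fin.suc (part c r i) ≟ j)))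
    count-blocks j = sumFin-cong (c * r) (λ i → cong (λ x → χ (does (x ≟ j))) (rest i))
    count-first : ∀ j → sumFin r (λ i → χ (does (part (suc c) r (i ↑ˡ c * r) ≟ j)))
                      ≡ sumFin r (λ i → χ (does (Fin.zero ≟ j)))
    count-first j = sumFin-cong r (λ i → cong (λ x → χ (does (x ≟ j))) (first i))
    by-part : ∀ j → sumFin r (λ i → χ (does (part (suc c) r (i ↑ˡ c * r) ≟ j)))
                  + sumFin (c * r) (λ i → χ (does (part (suc c) r (r ↑ʳ i) ≟ j))) ≡ r
    by-part Fin.zero    = trans (cong₂ _+_ (trans (count-first Fin.zero) (sumFin-one r))
                                           (trans (count-blocks Fin.zero) (sumFin-zero (c * r))))
                                (+-identityʳ r)
    by-part (Fin.suc j) = trans (cong₂ _+_ (trans (count-first (Fin.suc j)) (sumFin-zero r))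
                                           (trans (count-blocks (Fin.suc j)) (part-count c r j)))
                                refl

  module ExtremalGraph (m c₁ c₂ r : ℕ) where

    M : ℕ
    M = c₁ * r + c₂ * suc r

    H : Adj (m + M)
    H = join (complete m) (join (joinCopies c₁ r) (joinCopies c₂ (suc r)))

    Class : Set
    Class = Fin c₁ ⊎ Fin c₂

    _≟Class_ : DecidableEquality Class
    _≟Class_ = Sum.≡-dec _≟_ _≟_

    classOf : Fin M → Class
    classOf y = [ inj₁ ∘ part c₁ r , inj₂ ∘ part c₂ (suc r) ] (splitAt (c₁ * r) y)

    labelH : Fin (m + M) → Maybe Class
    labelH x = [ (λ _ → nothing) , (λ y → just (classOf y)) ] (splitAt m x)

    parts-by-class : ∀ a b → join (joinCopies c₁ r) (joinCopies c₂ (suc r)) a b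
                             ≡ not (does (classOf b ≟Class classOf a))
    parts-by-class a b with splitAt (c₁ * r) a | splitAt (c₁ * r) b
    ... | inj₁ x | inj₁ y = joinCopies-by-part c₁ r x y
    ... | inj₁ _ | inj₂ _ = refl
    ... | inj₂ _ | inj₁ _ = refl
    ... | inj₂ x | inj₂ y = joinCopies-by-part c₂ (suc r) x y

    H-multipartite : MultipartiteBy _≟Class_ H labelH
    H-multipartite = loopless , by-class
      where
      loopless : ∀ x → H x x ≡ false
      loopless x with splitAt m x
      ... | inj₁ a = cong not (≟-refl a)
      ... | inj₂ a = trans (parts-by-class a a) (cong not (dec-true (classOf a ≟Class classOf a) refl))
      by-class : ∀ x y → ¬ x ≡ y → H x y ≡ not (sameClass _≟Class_ (labelH x) (labelH y))
      by-class x y x≢y with splitAt m x in sx | splitAt m y in sy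
      ... | inj₁ a | inj₁ b = cong not (≟-≢ (λ { refl → x≢y (trans (sym (splitAt⁻¹-↑ˡ sx)) (splitAt⁻¹-↑ˡ sy)) }))
      ... | inj₁ _ | inj₂ _ = refl
      ... | inj₂ _ | inj₁ _ = refl
      ... | inj₂ a | inj₂ b = parts-by-class a b

    count-split : ∀ l → labelCount _≟Class_ labelH l
      ≡ sumFin m (λ _ → χ (does (≡-dec _≟Class_ nothing l)))
        + sumFin M (λ y → χ (does (≡-dec _≟Class_ (just (classOf y)) l)))
    count-split l = trans (sumFin-++ m M _)
      (cong₂ _+_ (sumFin-cong m (λ i → cong (λ z → χ (does (≡-dec _≟Class_ z l))) (left i)))
                 (sumFin-cong M (λ j → cong (λ z → χ (does (≡-dec _≟Class_ z l))) (right j))))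
      where
      left : ∀ i → labelH (i ↑ˡ M) ≡ nothing
      left i rewrite splitAt-↑ˡ m i M = refl
      right : ∀ j → labelH (m ↑ʳ j) ≡ just (classOf j)
      right j rewrite splitAt-↑ʳ m M j = refl

    classes-split : ∀ l → sumFin M (λ y → χ (does (classOf y ≟Class l)))
      ≡ sumFin (c₁ * r) (λ z → χ (does (inj₁ (part c₁ r z) ≟Class l)))
        + sumFin (c₂ * suc r) (λ z → χ (does (inj₂ (part c₂ (suc r) z) ≟Class l)))
    classes-split l = trans (sumFin-++ (c₁ * r) (c₂ * suc r) _)
      (cong₂ _+_ (sumFin-cong (c₁ * r) (λ i → cong (λ z → χ (does (z ≟Class l))) (left i)))
                 (sumFin-cong (c₂ * suc r) (λ j → cong (λ z → χ (does (z ≟Class l))) (right j))))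
      where
      left : ∀ i → classOf (i ↑ˡ c₂ * suc r) ≡ inj₁ (part c₁ r i)
      left i rewrite splitAt-↑ˡ (c₁ * r) i (c₂ * suc r) = refl
      right : ∀ j → classOf (c₁ * r ↑ʳ j) ≡ inj₂ (part c₂ (suc r) j)
      right j rewrite splitAt-↑ʳ (c₁ * r) (c₂ * suc r) j = refl

    count-clique : labelCount _≟Class_ labelH nothing ≡ m
    count-clique = trans (count-split nothing)
      (trans (cong₂ _+_ (sumFin-one m) (sumFin-zero M)) (+-identityʳ m))

    count-small : ∀ j → labelCount _≟Class_ labelH (just (inj₁ j)) ≡ r
    count-small j = trans (count-split _) (trans (cong₂ _+_ (sumFin-zero m) (classes-split (inj₁ j)))
      (trans (cong (_+ sumFin (c₂ * suc r) (λ _ → 0)) (part-count c₁ r j))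
             (trans (cong (r +_) (sumFin-zero (c₂ * suc r))) (+-identityʳ r))))

    count-large : ∀ j → labelCount _≟Class_ labelH (just (inj₂ j)) ≡ suc r
    count-large j = trans (count-split _) (trans (cong₂ _+_ (sumFin-zero m) (classes-split (inj₂ j)))
      (cong₂ _+_ (sumFin-zero (c₁ * r)) (part-count c₂ (suc r) j)))

module EqualityCase where

  open import Defs
  open FiniteSums
  open Counting
  open Labellings using (Label)
  open MultipartiteGraphs
  open ExtremalGraphs
  open import Data.Nat using (ℕ; suc; _+_; _*_; _∸_; _≤_; _<_)
  import Data.Nat as ℕ
  open import Data.Nat.Properties using (≡ᵇ⇒≡; ≡⇒≡ᵇ; +-identityʳ; +-comm; *-comm; m+n∸n≡m; m∸n+n≡m; +-cancelˡ-≡)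
  open import Data.Bool using (Bool; true; false; not; T)
  open import Data.Bool.Properties using (T-≡)
  open import Data.Fin using (Fin; _≟_)
  open import Data.Fin.Properties using (+↔⊎)
  open import Data.Maybe using (Maybe; just; nothing)
  open import Data.Maybe.Properties using (≡-dec)
  open import Data.Sum using (_⊎_; inj₁; inj₂)
  open import Data.Product using (_,_; ∃-syntax; proj₁; proj₂)
  open import Function using (_∘_)
  open import Function.Bundles using (_↔_; Inverse; Equivalence)
  open import Function.Properties.Inverse using (↔-sym; ↔-trans)
  open import Relation.Nullary using (does; contradiction)
  open import Relation.Binary using (DecidableEquality)
  open import Relation.Binary.PropositionalEquality

  open Inverse using (to; from)

  -- The classes are sorted by
  -- size and matched with the parts of the extremal graph.
  module _ {n k : ℕ} (G : Adj n) (ℓ : Fin n → Label k) (m s t : ℕ)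
    (multipartite : MultipartiteBy _≟_ G ℓ)
    (clique : labelCount _≟_ ℓ nothing ≡ m)
    (balanced : ∀ i → labelCount _≟_ ℓ (just i) ≡ s ⊎ labelCount _≟_ ℓ (just i) ≡ suc s)
    (total : sumFin k (λ i → labelCount _≟_ ℓ (just i)) ≡ s * k + t) where

    private
      size : Fin k → ℕ
      size i = labelCount _≟_ ℓ (just i)

      small : Fin k → Bool
      small i = size i ℕ.≡ᵇ s

      nSmall nLarge : ℕ
      nSmall = sumFin k (χ ∘ small)
      nLarge = sumFin k (χ ∘ not ∘ small)

      size-split : ∀ i → size i ≡ s + χ (not (small i))
      size-split i with size i ℕ.≡ᵇ s in e | balanced i
      ... | true  | _      = trans (≡ᵇ⇒≡ (size i) s (Equivalence.from T-≡ e)) (sym (+-identityʳ s))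
      ... | false | inj₁ p = contradiction (subst T e (≡⇒≡ᵇ (size i) s p)) λ ()
      ... | false | inj₂ p = trans p (+-comm 1 s)

      nLarge≡t : nLarge ≡ t
      nLarge≡t = +-cancelˡ-≡ (s * k) _ _ (begin
        s * k + nLarge                      ≡⟨ cong (_+ nLarge) (trans (*-comm s k) (sym (sumFin-const k s))) ⟩
        sumFin k (λ _ → s) + nLarge         ≡⟨ sym (sumFin-+ k _ _) ⟩
        sumFin k (λ i → s + χ (not (small i))) ≡⟨ sym (sumFin-cong k size-split) ⟩
        sumFin k size                       ≡⟨ total ⟩
        s * k + t                           ∎)
        where open ≡-Reasoning

      nSmall≡ : nSmall ≡ k ∸ t
      nSmall≡ = begin
        nSmall                 ≡⟨ sym (m+n∸n≡m nSmall nLarge) ⟩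
        nSmall + nLarge ∸ nLarge ≡⟨ cong₂ _∸_ (trans (sym (sumFin-+ k _ _)) (trans (sumFin-cong k (complement ∘ small)) (sumFin-one k))) nLarge≡t ⟩
        k ∸ t                  ∎
        where
        open ≡-Reasoning
        complement : ∀ b → χ b + χ (not b) ≡ 1
        complement true  = refl
        complement false = refl

      small⇒ : ∀ i → small i ≡ true → size i ≡ s
      small⇒ i e = ≡ᵇ⇒≡ (size i) s (Equivalence.from T-≡ e)

      large⇒ : ∀ i → small i ≡ false → size i ≡ suc s
      large⇒ i e with balanced i
      ... | inj₂ p = p
      ... | inj₁ p = contradiction (subst T e (≡⇒≡ᵇ (size i) s p)) λ ()

    multipartite⇒extremal : G ≅ ExtremalGraph.H m (k ∸ t) t s
    multipartite⇒extremal = subst₂ (λ a b → G ≅ ExtremalGraph.H m a b s) nSmall≡ nLarge≡t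
      (multipartite-iso _≟_ _≟Class_ G H ℓ labelH π multipartite H-multipartite sizes)
      where
      open ExtremalGraph m nSmall nLarge s
      π : Fin k ↔ Class
      π = proj₁ (partition↔ k small)
      sizes : ∀ l → labelCount _≟_ ℓ l ≡ labelCount _≟Class_ labelH (to (↔-Maybe π) l)
      sizes nothing = trans clique (sym count-clique)
      sizes (just i) with to π i | proj₂ (partition↔ k small) i
      ... | inj₁ j | side = trans (small⇒ i (sym side)) (sym (count-small j))
      ... | inj₂ j | side = trans (large⇒ i (sym side)) (sym (count-large j))

  multipartite-≅ : ∀ {n N} {C : Set} (_≟C_ : DecidableEquality C) (A : Adj n) (B : Adj N)
    (ℓ : Fin N → Maybe C) (iso : A ≅ B) →
    MultipartiteBy _≟C_ B ℓ → MultipartiteBy _≟C_ A (ℓ ∘ to (proj₁ iso))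
  multipartite-≅ _≟C_ A B ℓ (φ , preserves) (loopless , by-class) =
    (λ u → trans (preserves u u) (loopless _)) ,
    (λ u v u≢v → trans (preserves u v) (by-class _ _ (λ e → u≢v (↔-injective φ e))))

  labelCount-≅ : ∀ {n N} {C : Set} (_≟C_ : DecidableEquality C) (ℓ : Fin N → Maybe C)
    (φ : Fin n ↔ Fin N) l → labelCount _≟C_ (ℓ ∘ to φ) l ≡ labelCount _≟C_ ℓ l
  labelCount-≅ _≟C_ ℓ φ l = count-↔ φ (λ x → does (≡-dec _≟C_ (ℓ x) l))

  multipartite-rename : ∀ {n} {C C′ : Set} (_≟C_ : DecidableEquality C) (_≟C′_ : DecidableEquality C′)
    (A : Adj n) (ℓ : Fin n → Maybe C) (π : C ↔ C′) →
    MultipartiteBy _≟C_ A ℓ → MultipartiteBy _≟C′_ A (to (↔-Maybe π) ∘ ℓ)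
  multipartite-rename _≟C_ _≟C′_ A ℓ π (loopless , by-class) =
    loopless , λ u v u≢v → trans (by-class u v u≢v) (cong not (sym (sameClass-↔ _≟C_ _≟C′_ π (ℓ u) (ℓ v))))

  labelCount-rename : ∀ {n} {C C′ : Set} (_≟C_ : DecidableEquality C) (_≟C′_ : DecidableEquality C′)
    (ℓ : Fin n → Maybe C) (π : C ↔ C′) l →
    labelCount _≟C′_ (to (↔-Maybe π) ∘ ℓ) (to (↔-Maybe π) l) ≡ labelCount _≟C_ ℓ l
  labelCount-rename {n} _≟C_ _≟C′_ ℓ π l =
    sumFin-cong n (λ u → cong χ (does-↔ (≡-dec _≟C_) (≡-dec _≟C′_) (↔-Maybe π) (ℓ u) l))

  module FromExtremal {n k m s t : ℕ} (t≤k : t ≤ k) (G : Adj n)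
    (iso : G ≅ ExtremalGraph.H m (k ∸ t) t s) where

    open ExtremalGraph m (k ∸ t) t s

    private
      ρ : Class ↔ Fin k
      ρ = ↔-trans (↔-sym +↔⊎) (↔-Fin (m∸n+n≡m t≤k))

      ℓH : Fin n → Maybe Class
      ℓH = labelH ∘ to (proj₁ iso)

    ℓ : Fin n → Label k
    ℓ = to (↔-Maybe ρ) ∘ ℓH

    multipartite : MultipartiteBy _≟_ G ℓ
    multipartite = multipartite-rename _≟Class_ _≟_ G ℓH ρ
      (multipartite-≅ _≟Class_ G H labelH iso H-multipartite)

    clique : labelCount _≟_ ℓ nothing ≡ m
    clique = trans (labelCount-rename _≟Class_ _≟_ ℓH ρ nothing)
                   (trans (labelCount-≅ _≟Class_ labelH (proj₁ iso) nothing) count-clique)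

    balanced : ∀ i → labelCount _≟_ ℓ (just i) ≡ s ⊎ labelCount _≟_ ℓ (just i) ≡ suc s
    balanced i = subst (λ j → labelCount _≟_ ℓ (just j) ≡ s ⊎ labelCount _≟_ ℓ (just j) ≡ suc s)
                       (Inverse.strictlyInverseˡ ρ i) (by-part (from ρ i))
      where
      part-size : ∀ c → labelCount _≟_ ℓ (just (to ρ c)) ≡ labelCount _≟Class_ labelH (just c)
      part-size c = trans (labelCount-rename _≟Class_ _≟_ ℓH ρ (just c))
                          (labelCount-≅ _≟Class_ labelH (proj₁ iso) (just c))
      by-part : ∀ c → labelCount _≟_ ℓ (just (to ρ c)) ≡ s ⊎ labelCount _≟_ ℓ (just (to ρ c)) ≡ suc s
      by-part (inj₁ j) = inj₁ (trans (part-size (inj₁ j)) (count-small j))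
      by-part (inj₂ j) = inj₂ (trans (part-size (inj₂ j)) (count-large j))

    deleted-vertex : 1 ≤ m → ∃[ w ] ℓ w ≡ nothing
    deleted-vertex 1≤m with sumFin-pos n _ (subst (0 <_) (sym clique) 1≤m)
    ... | w , positive = w , does-sound (≡-dec _≟_ (ℓ w) nothing) (χ-positive positive)

open import Defs
open FiniteSums
open Arithmetic using (wienerBound; excess-vanishes)
open Labellings
open MultipartiteGraphs
open ExtremalGraphs using (module ExtremalGraph)
open EqualityCase
open import Data.Nat using (ℕ; suc; _+_; _*_; _≤_; _<_; _∸_)
open import Data.Nat.Properties
  using (≤-trans; m≤m+n; m∸n+n≡m; m+[n∸m]≡n; +-cancelˡ-≡; +-cancelʳ-≤; +-comm; +-identityʳ; <-irrefl; <-≤-trans; n≤1+n; ≤-reflexive)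
open import Data.Integer using (+_; _-_)
import Data.Integer as I
import Data.Integer.Properties as IP
open import Data.Bool using (true; false; T; if_then_else_)
open import Data.Fin using (Fin; _≟_)
open import Data.Fin.Subset using (Subset; _∉_; ∣_∣)
open import Data.Vec using ([]; _∷_; lookup)
open import Data.Vec.Properties using ([]=⇒lookup)
open import Data.Maybe using (just; nothing)
open import Data.Maybe.Properties using (≡-dec)
open import Data.Product using (_×_; _,_; proj₁; proj₂)
open import Function.Bundles using (_⇔_; mk⇔)
open import Relation.Nullary using (yes; no; does; ¬_; contradiction)
open import Relation.Binary.PropositionalEquality

deletionLabelling : ∀ {n k} → Subset n → (Fin n → Fin k) → Fin n → Label k
deletionLabelling S c u = if lookup S u then nothing else just (c u)

module _ {n k : ℕ} (G : Adj n) (S : Subset n) (c : Fin n → Fin k)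
  (colouring : ∀ u v → u ∉ S → v ∉ S → T (G u v) → ¬ c u ≡ c v) where

  private
    ℓ : Fin n → Label k
    ℓ = deletionLabelling S c

    ∉S : ∀ u → lookup S u ≡ false → u ∉ S
    ∉S u e u∈S = contradiction (trans (sym e) ([]=⇒lookup u∈S)) λ ()

  deletion-proper : ∀ u v → sameClass _≟_ (ℓ u) (ℓ v) ≡ true → G u v ≡ false
  deletion-proper u v same with lookup S u in su | lookup S v in sv
  deletion-proper u v () | true  | _
  deletion-proper u v () | false | true
  ... | false | false with c v ≟ c u | G u v in uv
  ...   | yes cv≡cu | true  = contradiction (sym cv≡cu) (colouring u v (∉S u su) (∉S v sv) (subst T (sym uv) _))
  ...   | yes _     | false = refl
  ...   | no _      | _     = contradiction same λ ()

  deletion-count : labelCount _≟_ ℓ nothing ≡ ∣ S ∣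
  deletion-count = trans (sumFin-cong n indicator) (sym (size S))
    where
    indicator : ∀ u → χ (does (≡-dec _≟_ (ℓ u) nothing)) ≡ χ (lookup S u)
    indicator u with lookup S u
    ... | true  = refl
    ... | false = refl
    size : ∀ {n} (S : Subset n) → ∣ S ∣ ≡ sumFin n (λ u → χ (lookup S u))
    size []          = refl
    size (true ∷ S)  = cong suc (size S)
    size (false ∷ S) = size S

-- The hypotheses of the theorem.
module Proof (k n m s t : ℕ) (1≤m : 1 ≤ m) (m+k≤n : m + k ≤ n)
  (n-m : n ∸ m ≡ s * k + t) (t<k : t < k) (G : Adj n) (simple : IsSimple G)
  (vk : VertexKPartitenessAtMost k G m) where

  private
    G-sym : ∀ u v → G u v ≡ G v u
    G-sym = proj₁ simple
    loopless : ∀ u → G u u ≡ false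
    loopless = proj₂ simple
    S : Subset n
    S = proj₁ vk
    |S|≤m : ∣ S ∣ ≤ m
    |S|≤m = proj₁ (proj₂ vk)
    c : Fin n → Fin k
    c = proj₁ (proj₂ (proj₂ vk))
    colouring : ∀ u v → u ∉ S → v ∉ S → T (G u v) → ¬ c u ≡ c v
    colouring = proj₂ (proj₂ (proj₂ vk))

  n≡ : n ≡ (s * k + t) + m
  n≡ = trans (sym (m∸n+n≡m (≤-trans (m≤m+n m k) m+k≤n))) (cong (_+ m) n-m)

  -- Since k ≤ n − m = sk + t and t < k, the parts have size s ≥ 1.
  s≢0 : ¬ s ≡ 0
  s≢0 refl = <-irrefl refl (<-≤-trans t<k (+-cancelʳ-≤ m k t k+m≤t+m))
    where
    k+m≤t+m : k + m ≤ t + m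
    k+m≤t+m = subst₂ _≤_ (+-comm m k) n≡ m+k≤n

  ℓ₀ : Fin n → Label k
  ℓ₀ = deletionLabelling S c
  module L₀ = LabelledGraph G G-sym ℓ₀ (deletion-proper G S c colouring) s

  deleted≤m : L₀.nDeleted ≤ m
  deleted≤m = subst (_≤ m) (sym (deletion-count G S c colouring)) |S|≤m

  -- 2W = bound + excess for ℓ₀; as the excess is a natural number, the bound follows.
  excess-identity : I.+ (2 * wiener G) ≡ wienerBound n m s t I.+ I.+ L₀.excess m
  excess-identity = L₀.wiener-excess t m n≡ deleted≤m

  lower-bound : wienerBound n m s t I.≤ I.+ (2 * wiener G)
  lower-bound = subst (wienerBound n m s t I.≤_) (sym excess-identity) (IP.i≤i+j _ (I.+ L₀.excess m))

  Extremal : Adj (m + ((k ∸ t) * s + t * suc s))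
  Extremal = ExtremalGraph.H m (k ∸ t) t s

  -- Equality forces every part of the excess to vanish, which makes G complete
  -- multipartite by ℓ₀ with m deleted vertices and balanced classes.
  equality⇒extremal : I.+ (2 * wiener G) ≡ wienerBound n m s t → G ≅ Extremal
  equality⇒extremal tight =
    multipartite⇒extremal G ℓ₀ m s t multipartite clique (L₀.imbalance≡0⇒ balanced₀) total
    where
    parts : L₀.missingEdges ≡ 0 × L₀.imbalance ≡ 0 × m ∸ L₀.nDeleted ≡ 0
    parts = L₀.excess≡0⇒ m s≢0 (excess-vanishes _ _ (trans (sym excess-identity) tight))
    complete₀ : L₀.missingEdges ≡ 0
    complete₀ = proj₁ parts
    balanced₀ : L₀.imbalance ≡ 0
    balanced₀ = proj₁ (proj₂ parts)
    clique : L₀.nDeleted ≡ m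
    clique = trans (sym (+-identityʳ _)) (trans (cong (λ x → L₀.nDeleted + x) (sym (proj₂ (proj₂ parts))))
                                                (m+[n∸m]≡n deleted≤m))
    multipartite : MultipartiteBy _≟_ G ℓ₀
    multipartite = multipartite-intro _≟_ G ℓ₀ loopless (deletion-proper G S c colouring)
                                      (L₀.missingEdges≡0⇒ complete₀)
    total : L₀.nLabelled ≡ s * k + t
    total = +-cancelˡ-≡ m _ _ (trans (cong (_+ L₀.nLabelled) (sym clique))
                                     (trans L₀.deleted+labelled (trans n≡ (+-comm _ m))))

  -- Conversely, the labelling inherited from the extremal graph has no excess.
  extremal⇒equality : G ≅ Extremal → I.+ (2 * wiener G) ≡ wienerBound n m s t
  extremal⇒equality iso = begin
    I.+ (2 * wiener G)                     ≡⟨ L.wiener-excess t m n≡ (≤-reflexive clique) ⟩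
    wienerBound n m s t I.+ I.+ L.excess m ≡⟨ cong (λ E → wienerBound n m s t I.+ I.+ E) no-excess ⟩
    wienerBound n m s t I.+ I.+ 0          ≡⟨ IP.+-identityʳ _ ⟩
    wienerBound n m s t                    ∎
    where
    open ≡-Reasoning
    open FromExtremal {m = m} {s = s} (≤-trans (n≤1+n t) t<k) G iso
    module L = LabelledGraph G G-sym ℓ (multipartite-independent _≟_ G ℓ multipartite) s
    no-excess : L.excess m ≡ 0
    no-excess = L.⇒excess≡0 m
      (L.⇒distExcess≡0 (multipartite-common _≟_ G ℓ multipartite
                         (proj₁ (deleted-vertex 1≤m)) (proj₂ (deleted-vertex 1≤m))))
      (L.⇒missingEdges≡0 (multipartite-complete _≟_ G ℓ multipartite))
      (L.⇒imbalance≡0 balanced)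
      clique

theorem4p1 : (k n m s t : ℕ) → 1 ≤ k → 1 ≤ m → m + k ≤ n →
    n ∸ m ≡ s * k + t → t < k →
    (G : Adj n) → IsSimple G → Connected G → VertexKPartitenessAtMost k G m →
    ((+ (n * n) - + m) I.+ (+ (n ∸ m)) I.* (+ s - + 2) I.+ + (t * suc s)
        I.≤ + (2 * wiener G))
    × ((+ (2 * wiener G) ≡ (+ (n * n) - + m) I.+ (+ (n ∸ m)) I.* (+ s - + 2) I.+ + (t * suc s))
        ⇔ (G ≅ join (complete m) (join (joinCopies (k ∸ t) s) (joinCopies t (suc s)))))
theorem4p1 k n m s t _ 1≤m m+k≤n n-m t<k G simple _ vk =
  lower-bound , mk⇔ equality⇒extremal extremal⇒equality
  where open Proof k n m s t 1≤m m+k≤n n-m t<k G simple vk
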